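{- Let $F(q,z)=\sum_{n\ge0}\sum_{\sigma\in\mathcal{S}_n(2\text{ - }3\text{ - }1)}q^{(31\text{ - }2)\sigma}z^{n}$. Then, as formal power series, $$F(q,z)=\cfrac{1}{1-\cfrac{z}{1-\cfrac{z}{1-\cfrac{zq}{1-\cfrac{zq}{1-\cfrac{zq^2}{1-\cfrac{zq^2}{\ddots}}}}}}},$$ the continued fraction whose $k$th partial numerator ($k=0,1,2,\dots$) is $zq^{\lfloor k/2\rfloor}$.
   Context: $\mathcal{S}_n(2\text{ - }3\text{ - }1)$ is the set of permutations $\sigma$ of $\{1,\dots,n\}$ with no $i<j<k$ such that $\sigma_k<\sigma_i<\sigma_j$. $(31\text{ - }2)\sigma$ is the number of pairs $(i,j)$ with $i+1<j$ and $\sigma_{i+1}<\sigma_j<\sigma_i$ (occurrences of the vincular pattern $31\text{ - }2$). -}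

module Defs where

open import Data.Nat using (ℕ; zero; suc; _+_; _*_; _∸_; _<_; _≤_; _<?_; _≤?_)
open import Data.Nat.Properties using (_≟_)
open import Data.Fin using (Fin; toℕ)
import Data.Fin.Properties as FinP
open import Data.Vec using (Vec; []; _∷_; lookup)
open import Data.List using (List; []; _∷_; [_]; map; concatMap; filter; length; allFin; upTo)
open import Data.Product using (_×_; _,_; ∃)
open import Relation.Binary.PropositionalEquality using (_≡_)
open import Relation.Nullary using (Dec; yes; no; ¬_; ¬?)
open import Relation.Nullary.Decidable using (_×-dec_; _→-dec_)

-- Permutations of {1..n}, represented 0-based as σ : Vec (Fin n) n,
-- σ_i = lookup σ i.

IsPerm : ∀ {n} → Vec (Fin n) n → Set
IsPerm {n} σ = ∀ (i j : Fin n) → lookup σ i ≡ lookup σ j → i ≡ j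

isPerm? : ∀ {n} (σ : Vec (Fin n) n) → Dec (IsPerm σ)
isPerm? σ = FinP.all? λ i → FinP.all? λ j →
  (lookup σ i FinP.≟ lookup σ j) →-dec (i FinP.≟ j)

Occ231 : ∀ {n} → Vec (Fin n) n → Fin n → Fin n → Fin n → Set
Occ231 σ i j k = (toℕ i < toℕ j) × (toℕ j < toℕ k)
  × (toℕ (lookup σ k) < toℕ (lookup σ i)) × (toℕ (lookup σ i) < toℕ (lookup σ j))

occ231? : ∀ {n} (σ : Vec (Fin n) n) i j k → Dec (Occ231 σ i j k)
occ231? σ i j k = (toℕ i <? toℕ j) ×-dec (toℕ j <? toℕ k)
  ×-dec (toℕ (lookup σ k) <? toℕ (lookup σ i)) ×-dec (toℕ (lookup σ i) <? toℕ (lookup σ j))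

Avoids231 : ∀ {n} → Vec (Fin n) n → Set
Avoids231 {n} σ = ¬ (∃ λ (i : Fin n) → ∃ λ (j : Fin n) → ∃ λ (k : Fin n) → Occ231 σ i j k)

avoids231? : ∀ {n} (σ : Vec (Fin n) n) → Dec (Avoids231 σ)
avoids231? σ = ¬? (FinP.any? λ i → FinP.any? λ j → FinP.any? λ k → occ231? σ i j k)

-- An occurrence of the vincular pattern 31-2 is a pair (i,j) with
-- i+1 < j and σ_{i+1} < σ_j < σ_i.  We encode the pair (i,j) as the
-- triple (i, i', j) where i' is the position i+1 (toℕ i' ≡ suc (toℕ i));
-- i' is determined by i, so triples correspond bijectively to pairs.
Occ31-2 : ∀ {n} → Vec (Fin n) n → (Fin n × Fin n × Fin n) → Set
Occ31-2 σ (i , i' , j) = (toℕ i' ≡ suc (toℕ i)) × (toℕ i' < toℕ j)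
  × (toℕ (lookup σ i') < toℕ (lookup σ j)) × (toℕ (lookup σ j) < toℕ (lookup σ i))

occ31-2? : ∀ {n} (σ : Vec (Fin n) n) t → Dec (Occ31-2 σ t)
occ31-2? σ (i , i' , j) = (toℕ i' ≟ suc (toℕ i)) ×-dec (toℕ i' <? toℕ j)
  ×-dec (toℕ (lookup σ i') <? toℕ (lookup σ j)) ×-dec (toℕ (lookup σ j) <? toℕ (lookup σ i))

triples : ∀ n → List (Fin n × Fin n × Fin n)
triples n = concatMap (λ i → concatMap (λ i' → map (λ j → (i , i' , j)) (allFin n)) (allFin n)) (allFin n)

stat31-2 : ∀ {n} → Vec (Fin n) n → ℕ
stat31-2 {n} σ = length (filter (occ31-2? σ) (triples n))

allVec : ∀ m n → List (Vec (Fin n) m)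
allVec zero n = [ [] ]
allVec (suc m) n = concatMap (λ x → map (x ∷_) (allVec m n)) (allFin n)

permCount : ℕ → ℕ → ℕ
permCount n k = length (filter (λ σ → isPerm? σ ×-dec avoids231? σ ×-dec (stat31-2 σ ≟ k)) (allVec n n))

-- Formal power series in z and q with ℕ coefficients:
-- A n k = coefficient of z^n q^k.

Series : Set
Series = ℕ → ℕ → ℕ

sumTo : ℕ → (ℕ → ℕ) → ℕ
sumTo zero f = f 0
sumTo (suc n) f = sumTo n f + f (suc n)

one : Series
one zero zero = 1
one _ _ = 0

_⊗_ : Series → Series → Series
(A ⊗ B) n k = sumTo n λ i → sumTo k λ j → A i j * B (n ∸ i) (k ∸ j)

zq^ : ℕ → Series → Series
zq^ e A zero k = 0
zq^ e A (suc n) k with e ≤? k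
... | yes _ = A n (k ∸ e)
... | no _ = 0

pow : Series → ℕ → Series
pow X zero = one
pow X (suc m) = X ⊗ pow X m

-- 1/(1 - X) for X with zero z^0-part, as the geometric series
-- Σ_m X^m; since X^m only has z-degree ≥ m, the z^n coefficient is
-- the finite sum over m ≤ n.
geom : Series → Series
geom X n k = sumTo n λ m → pow X m n k

-- convergents of the continued fraction with k-th partial numerator
-- z q^{⌊k/2⌋}:  C d k = 1/(1 - z q^{⌊k/2⌋} C (d-1) (k+1)),  C 0 k = 1.
half : ℕ → ℕ
half zero = zero
half (suc zero) = zero
half (suc (suc k)) = suc (half k)

convergent : ℕ → ℕ → Series
convergent zero k = one
convergent (suc d) k = geom (zq^ (half k) (convergent d (suc k)))

-- A 231-avoiding permutation with first entry a is a L R′, where L is a 231-avoiding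
-- arrangement of the values below a and R′ one of the values above a. An occurrence of 31-2
-- lies inside L, inside R′, or has a as its 3 and the head of L as its 1. Let G refine F by
-- also counting the entries that exceed the first one; then the decomposition gives
-- F_{n+1} = Σ_{a+b=n} G_a F_b and G_{n+1} = Σ_{a+b=n} G_a q^b F_b, since all b entries of R′
-- exceed a. These are the equations satisfied by the tails of the continued fraction at even
-- and odd depth, so the z^n coefficient of the convergents is that of F from depth n on.
module Submission where

open import Defs
open import Data.Bool using (Bool; true; false; _∧_; not; if_then_else_)
open import Data.Bool.ListAction using (all)
open import Data.Bool.Properties using (T-≡; ∧-zeroʳ; ∧-identityʳ; ∧-assoc)
open import Data.Empty using (⊥-elim)
open import Data.Fin using (Fin; zero; suc; toℕ)
import Data.Fin.Properties as Fin
open import Data.List using (List; []; _∷_; _++_; length; map; filter; filterᵇ; concatMap; tabulate; allFin)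
open import Data.List.Properties
  using (length-++; length-map; map-id; map-++; map-∘; map-cong; map-tabulate; tabulate-cong)
open import Data.Nat
open import Data.Nat.Induction using (<-rec)
open import Data.Nat.ListAction using (sum)
open import Data.Nat.ListAction.Properties using (sum-++)
open import Data.Nat.Properties
open import Algebra.Properties.CommutativeSemigroup +-commutativeSemigroup using (interchange)
open import Data.Nat.Solver using (module +-*-Solver)
open import Data.Product using (_×_; _,_; ∃; proj₁; proj₂)
open import Data.Vec using (Vec; []; _∷_; lookup; toList)
import Data.Vec as Vec
open import Data.Vec.Properties using (lookup-map)
open import Function using (_∘_; id; case_of_; Equivalence)
open import Function.Definitions using (Injective)
open import Relation.Binary.Definitions using (tri<; tri≈; tri>)
open import Relation.Binary.PropositionalEquality
open import Relation.Nullary using (¬_; Dec; yes; no; does)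
open import Relation.Unary using (Decidable)

open ≡-Reasoning

<⇒<ᵇ≡true : ∀ {m n} → m < n → (m <ᵇ n) ≡ true
<⇒<ᵇ≡true m<n = Equivalence.to T-≡ (<⇒<ᵇ m<n)

≤⇒≤ᵇ≡true : ∀ {m n} → m ≤ n → (m ≤ᵇ n) ≡ true
≤⇒≤ᵇ≡true m≤n = Equivalence.to T-≡ (≤⇒≤ᵇ m≤n)

<ᵇ≡true⇒< : ∀ m n → (m <ᵇ n) ≡ true → m < n
<ᵇ≡true⇒< m n eq = <ᵇ⇒< m n (Equivalence.from T-≡ eq)

≤ᵇ≡true⇒≤ : ∀ m n → (m ≤ᵇ n) ≡ true → m ≤ n
≤ᵇ≡true⇒≤ m n eq = ≤ᵇ⇒≤ m n (Equivalence.from T-≡ eq)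

∧≡true⇒× : ∀ {a b} → (a ∧ b) ≡ true → a ≡ true × b ≡ true
∧≡true⇒× {true} {true} _ = refl , refl

≡-by-≡true : ∀ {b c : Bool} → (b ≡ true → c ≡ true) → (c ≡ true → b ≡ true) → b ≡ c
≡-by-≡true {true}  {true}  _ _ = refl
≡-by-≡true {true}  {false} f _ = sym (f refl)
≡-by-≡true {false} {true}  _ g = g refl
≡-by-≡true {false} {false} _ _ = refl

≡ᵇ≡true⇒≡ : ∀ m n → (m ≡ᵇ n) ≡ true → m ≡ n
≡ᵇ≡true⇒≡ m n eq = ≡ᵇ⇒≡ m n (Equivalence.from T-≡ eq)

≡⇒≡ᵇ≡true : ∀ {m n} → m ≡ n → (m ≡ᵇ n) ≡ true
≡⇒≡ᵇ≡true {m} {n} eq = Equivalence.to T-≡ (≡⇒≡ᵇ m n eq)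

≢⇒≡ᵇ≡false : ∀ {m n} → m ≢ n → (m ≡ᵇ n) ≡ false
≢⇒≡ᵇ≡false {m} {n} m≢n with m ≡ᵇ n in eq
... | true  = ⊥-elim (m≢n (≡ᵇ≡true⇒≡ m n eq))
... | false = refl

not-≡ᵇ⇒≢ : ∀ m n → not (m ≡ᵇ n) ≡ true → m ≢ n
not-≡ᵇ⇒≢ m .m eq refl = case trans (sym eq) (cong not (≡⇒≡ᵇ≡true {m} refl)) of λ ()

<ᵇ-+ˡ : ∀ c x y → (c + x <ᵇ c + y) ≡ (x <ᵇ y)
<ᵇ-+ˡ zero    x y = refl
<ᵇ-+ˡ (suc c) x y = <ᵇ-+ˡ c x y

≡ᵇ-+ˡ : ∀ c x y → (c + x ≡ᵇ c + y) ≡ (x ≡ᵇ y)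
≡ᵇ-+ˡ zero    x y = refl
≡ᵇ-+ˡ (suc c) x y = ≡ᵇ-+ˡ c x y

≤ᵇ-+ˡ : ∀ c x y → (c + x ≤ᵇ c + y) ≡ (x ≤ᵇ y)
≤ᵇ-+ˡ c x y = ≡-by-≡true (λ eq → ≤⇒≤ᵇ≡true (+-cancelˡ-≤ c x y (≤ᵇ≡true⇒≤ _ _ eq)))
                         (λ eq → ≤⇒≤ᵇ≡true (+-monoʳ-≤ c (≤ᵇ≡true⇒≤ x y eq)))

≢∧≮⇒>ᵇ : ∀ a x → not (a ≡ᵇ x) ≡ true → (a <ᵇ x) ≡ false → (x <ᵇ a) ≡ true
≢∧≮⇒>ᵇ a x a≢x a≮x with <-cmp a x
... | tri< a<x _ _ = case trans (sym a≮x) (<⇒<ᵇ≡true a<x) of λ ()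
... | tri≈ _ a≡x _ = ⊥-elim (not-≡ᵇ⇒≢ a x a≢x a≡x)
... | tri> _ _ x<a = <⇒<ᵇ≡true x<a

sumTo-cong : ∀ n {f g : ℕ → ℕ} → (∀ i → i ≤ n → f i ≡ g i) → sumTo n f ≡ sumTo n g
sumTo-cong zero    f≡g = f≡g 0 z≤n
sumTo-cong (suc n) f≡g =
  cong₂ _+_ (sumTo-cong n (λ i i≤n → f≡g i (m≤n⇒m≤1+n i≤n))) (f≡g (suc n) ≤-refl)

sumTo-zero : ∀ n {f : ℕ → ℕ} → (∀ i → i ≤ n → f i ≡ 0) → sumTo n f ≡ 0
sumTo-zero zero    f≡0 = f≡0 0 z≤n
sumTo-zero (suc n) f≡0 =
  cong₂ _+_ (sumTo-zero n (λ i i≤n → f≡0 i (m≤n⇒m≤1+n i≤n))) (f≡0 (suc n) ≤-refl)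

sumTo-suc : ∀ n (f : ℕ → ℕ) → sumTo (suc n) f ≡ f 0 + sumTo n (f ∘ suc)
sumTo-suc zero    f = refl
sumTo-suc (suc n) f = begin
  sumTo (suc n) f + f (2 + n)            ≡⟨ cong (_+ f (2 + n)) (sumTo-suc n f) ⟩
  f 0 + sumTo n (f ∘ suc) + f (2 + n)    ≡⟨ +-assoc (f 0) _ _ ⟩
  f 0 + sumTo (suc n) (f ∘ suc)          ∎

sumTo-distrib-+ : ∀ n (f g : ℕ → ℕ) → sumTo n (λ i → f i + g i) ≡ sumTo n f + sumTo n g
sumTo-distrib-+ zero    f g = refl
sumTo-distrib-+ (suc n) f g = trans (cong (_+ (f (suc n) + g (suc n))) (sumTo-distrib-+ n f g))
  (interchange (sumTo n f) (sumTo n g) (f (suc n)) (g (suc n)))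

sumTo-*ˡ : ∀ n c (f : ℕ → ℕ) → sumTo n (λ i → c * f i) ≡ c * sumTo n f
sumTo-*ˡ zero    c f = refl
sumTo-*ˡ (suc n) c f = trans (cong (_+ c * f (suc n)) (sumTo-*ˡ n c f)) (sym (*-distribˡ-+ c _ _))

sumTo-swap : ∀ n m (f : ℕ → ℕ → ℕ) →
  sumTo n (λ i → sumTo m (f i)) ≡ sumTo m (λ j → sumTo n (λ i → f i j))
sumTo-swap zero    m f = refl
sumTo-swap (suc n) m f = trans (cong (_+ sumTo m (f (suc n))) (sumTo-swap n m f))
  (sym (sumTo-distrib-+ m (λ j → sumTo n (λ i → f i j)) (f (suc n))))

sumTo-reverse : ∀ n (f : ℕ → ℕ) → sumTo n f ≡ sumTo n (λ i → f (n ∸ i))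
sumTo-reverse zero    f = refl
sumTo-reverse (suc n) f = begin
  sumTo n f + f (suc n)                  ≡⟨ +-comm (sumTo n f) _ ⟩
  f (suc n) + sumTo n f                  ≡⟨ cong (f (suc n) +_) (sumTo-reverse n f) ⟩
  f (suc n) + sumTo n (λ i → f (n ∸ i))  ≡⟨ sumTo-suc n (λ i → f (suc n ∸ i)) ⟨
  sumTo (suc n) (λ i → f (suc n ∸ i))    ∎

sumTo-truncate : ∀ n p (f : ℕ → ℕ) → p ≤ n → (∀ i → p < i → f i ≡ 0) → sumTo n f ≡ sumTo p f
sumTo-truncate zero    .zero f z≤n f≡0 = refl
sumTo-truncate (suc n) p     f p≤n f≡0 with p ≟ suc n
... | yes refl = refl
... | no  p≢n  = trans (cong₂ _+_ (sumTo-truncate n p f (≤-pred p<n) f≡0) (f≡0 (suc n) p<n))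
                       (+-identityʳ _)
  where p<n = ≤∧≢⇒< p≤n p≢n

sumTo-single : ∀ n x (f : ℕ → ℕ) → x ≤ n → (∀ j → j ≤ n → j ≢ x → f j ≡ 0) → sumTo n f ≡ f x
sumTo-single zero    .zero f z≤n f≡0 = refl
sumTo-single (suc n) x     f x≤n f≡0 with x ≟ suc n
... | yes refl = cong (_+ f (suc n))
  (sumTo-zero n (λ j j≤n → f≡0 j (m≤n⇒m≤1+n j≤n) (<⇒≢ (s≤s j≤n))))
... | no  x≢n  = trans
  (cong₂ _+_ (sumTo-single n x f (≤-pred (≤∧≢⇒< x≤n x≢n)) (λ j j≤n → f≡0 j (m≤n⇒m≤1+n j≤n)))
             (f≡0 (suc n) ≤-refl (x≢n ∘ sym)))
  (+-identityʳ (f x))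

sumBelow : ℕ → (ℕ → ℕ) → ℕ
sumBelow m f = sum (tabulate {n = m} (f ∘ toℕ))

sumBelow-cong : ∀ m {f g : ℕ → ℕ} → (∀ x → x < m → f x ≡ g x) → sumBelow m f ≡ sumBelow m g
sumBelow-cong zero    f≡g = refl
sumBelow-cong (suc m) f≡g = cong₂ _+_ (f≡g 0 z<s) (sumBelow-cong m (λ x x<m → f≡g (suc x) (s<s x<m)))

sumBelow-zero : ∀ m {f : ℕ → ℕ} → (∀ x → x < m → f x ≡ 0) → sumBelow m f ≡ 0
sumBelow-zero zero    f≡0 = refl
sumBelow-zero (suc m) f≡0 = cong₂ _+_ (f≡0 0 z<s) (sumBelow-zero m (λ x x<m → f≡0 (suc x) (s<s x<m)))

sumBelow-*ˡ : ∀ m c (f : ℕ → ℕ) → sumBelow m (λ x → c * f x) ≡ c * sumBelow m f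
sumBelow-*ˡ zero    c f = sym (*-zeroʳ c)
sumBelow-*ˡ (suc m) c f =
  trans (cong (c * f 0 +_) (sumBelow-*ˡ m c (f ∘ suc))) (sym (*-distribˡ-+ c _ _))

sumBelow-sumTo : ∀ m k (f : ℕ → ℕ → ℕ) →
  sumBelow m (λ x → sumTo k (f x)) ≡ sumTo k (λ j → sumBelow m (λ x → f x j))
sumBelow-sumTo zero    k f = sym (sumTo-zero k (λ _ _ → refl))
sumBelow-sumTo (suc m) k f = trans (cong (sumTo k (f 0) +_) (sumBelow-sumTo m k (f ∘ suc)))
  (sym (sumTo-distrib-+ k (f 0) (λ j → sumBelow m (λ x → f (suc x) j))))

sumBelow-+ : ∀ p q (f : ℕ → ℕ) → sumBelow (p + q) f ≡ sumBelow p f + sumBelow q (λ x → f (p + x))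
sumBelow-+ zero    q f = refl
sumBelow-+ (suc p) q f = trans (cong (f 0 +_) (sumBelow-+ p q (f ∘ suc))) (sym (+-assoc (f 0) _ _))

sumBelow-suc : ∀ n (f : ℕ → ℕ) → sumBelow (suc n) f ≡ sumTo n f
sumBelow-suc zero    f = +-identityʳ (f 0)
sumBelow-suc (suc n) f = trans (cong (f 0 +_) (sumBelow-suc n (f ∘ suc))) (sym (sumTo-suc n f))

inWindow : ℕ → ℕ → ℕ → Bool
inWindow c w x = (c ≤ᵇ x) ∧ (x <ᵇ c + w)

sumBelow-window : ∀ c w m (f : ℕ → ℕ) → c + w ≤ m →
  (∀ x → x < m → inWindow c w x ≡ false → f x ≡ 0) → sumBelow m f ≡ sumBelow w (λ y → f (c + y))
sumBelow-window c w m f c+w≤m f≡0 with m≤n⇒∃[o]m+o≡n c+w≤m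
... | r , refl = begin
  sumBelow (c + w + r) f
    ≡⟨ sumBelow-+ (c + w) r f ⟩
  sumBelow (c + w) f + sumBelow r (λ x → f (c + w + x))
    ≡⟨ cong₂ _+_ (sumBelow-+ c w f)
                 (sumBelow-zero r (λ x x<r → f≡0 _ (+-monoʳ-< (c + w) x<r) (above x))) ⟩
  sumBelow c f + sumBelow w (λ y → f (c + y)) + 0
    ≡⟨ +-identityʳ _ ⟩
  sumBelow c f + sumBelow w (λ y → f (c + y))
    ≡⟨ cong (_+ sumBelow w (λ y → f (c + y)))
            (sumBelow-zero c (λ x x<c → f≡0 x (<-≤-trans x<c c≤m) (below x x<c))) ⟩
  sumBelow w (λ y → f (c + y))
    ∎
  where
  c≤m : c ≤ c + w + r
  c≤m = ≤-trans (m≤m+n c w) (m≤m+n (c + w) r)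
  below : ∀ x → x < c → inWindow c w x ≡ false
  below x x<c with c ≤ᵇ x in eq
  ... | true  = ⊥-elim (<⇒≱ x<c (≤ᵇ≡true⇒≤ c x eq))
  ... | false = refl
  above : ∀ x → inWindow c w (c + w + x) ≡ false
  above x with (c + w + x) <ᵇ c + w in eq
  ... | true  = ⊥-elim (<⇒≱ (<ᵇ≡true⇒< _ _ eq) (m≤m+n (c + w) x))
  ... | false = ∧-zeroʳ _

-- Power series in q

shift : ℕ → (ℕ → ℕ) → ℕ → ℕ
shift zero    f l       = f l
shift (suc a) f zero    = 0
shift (suc a) f (suc l) = shift a f l

infixl 7 _∗_
_∗_ : (ℕ → ℕ) → (ℕ → ℕ) → ℕ → ℕ
(f ∗ g) j = sumTo j (λ l → f l * g (j ∸ l))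

shift-≤ : ∀ a f k → a ≤ k → shift a f k ≡ f (k ∸ a)
shift-≤ zero    f k       _         = refl
shift-≤ (suc a) f (suc k) (s≤s a≤k) = shift-≤ a f k a≤k

shift-> : ∀ a f k → ¬ a ≤ k → shift a f k ≡ 0
shift-> zero    f k       a≰k = ⊥-elim (a≰k z≤n)
shift-> (suc a) f zero    a≰k = refl
shift-> (suc a) f (suc k) a≰k = shift-> a f k (a≰k ∘ s≤s)

shift-cong : ∀ a {f g : ℕ → ℕ} → (∀ l → f l ≡ g l) → ∀ l → shift a f l ≡ shift a g l
shift-cong zero    f≡g l       = f≡g l
shift-cong (suc a) f≡g zero    = refl
shift-cong (suc a) f≡g (suc l) = shift-cong a f≡g l

shift-+ : ∀ a b f l → shift a (shift b f) l ≡ shift (a + b) f l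
shift-+ zero    b f l       = refl
shift-+ (suc a) b f zero    = refl
shift-+ (suc a) b f (suc l) = shift-+ a b f l

shift-*ˡ : ∀ a c f l → shift a (λ y → c * f y) l ≡ c * shift a f l
shift-*ˡ a c f l with a ≤? l
... | yes a≤l = trans (shift-≤ a _ l a≤l) (cong (c *_) (sym (shift-≤ a f l a≤l)))
... | no  a≰l = trans (shift-> a _ l a≰l) (sym (trans (cong (c *_) (shift-> a f l a≰l)) (*-zeroʳ c)))

shift-sumTo : ∀ a n (f : ℕ → ℕ → ℕ) l →
  shift a (λ l → sumTo n (λ i → f i l)) l ≡ sumTo n (λ i → shift a (f i) l)
shift-sumTo zero    n f l       = refl
shift-sumTo (suc a) n f zero    = sym (sumTo-zero n (λ _ _ → refl))
shift-sumTo (suc a) n f (suc l) = shift-sumTo a n f l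

∗-cong : ∀ {f f′ g g′ : ℕ → ℕ} → (∀ l → f l ≡ f′ l) → (∀ l → g l ≡ g′ l) →
  ∀ j → (f ∗ g) j ≡ (f′ ∗ g′) j
∗-cong f≡f′ g≡g′ j = sumTo-cong j (λ l _ → cong₂ _*_ (f≡f′ l) (g≡g′ (j ∸ l)))

∗-comm : ∀ f g j → (f ∗ g) j ≡ (g ∗ f) j
∗-comm f g j = begin
  sumTo j (λ l → f l * g (j ∸ l))
    ≡⟨ sumTo-reverse j _ ⟩
  sumTo j (λ l → f (j ∸ l) * g (j ∸ (j ∸ l)))
    ≡⟨ sumTo-cong j (λ l l≤j →
         trans (*-comm (f (j ∸ l)) _) (cong (λ x → g x * f (j ∸ l)) (m∸[m∸n]≡n l≤j))) ⟩
  sumTo j (λ l → g l * f (j ∸ l))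
    ∎

∗-shiftˡ : ∀ a f g j → (shift a f ∗ g) j ≡ shift a (f ∗ g) j
∗-shiftˡ zero    f g j       = refl
∗-shiftˡ (suc a) f g zero    = refl
∗-shiftˡ (suc a) f g (suc j) =
  trans (sumTo-suc j (λ l → shift (suc a) f l * g (suc j ∸ l))) (∗-shiftˡ a f g j)

∗-shiftʳ : ∀ b f g j → (f ∗ shift b g) j ≡ shift b (f ∗ g) j
∗-shiftʳ b f g j = begin
  (f ∗ shift b g) j  ≡⟨ ∗-comm f (shift b g) j ⟩
  (shift b g ∗ f) j  ≡⟨ ∗-shiftˡ b g f j ⟩
  shift b (g ∗ f) j  ≡⟨ shift-cong b (∗-comm g f) j ⟩
  shift b (f ∗ g) j  ∎

∗-shift : ∀ a b f g j → (shift a f ∗ shift b g) j ≡ shift (a + b) (f ∗ g) j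
∗-shift a b f g j = begin
  (shift a f ∗ shift b g) j  ≡⟨ ∗-shiftˡ a f (shift b g) j ⟩
  shift a (f ∗ shift b g) j  ≡⟨ shift-cong a (∗-shiftʳ b f g) j ⟩
  shift a (shift b (f ∗ g)) j ≡⟨ shift-+ a b (f ∗ g) j ⟩
  shift (a + b) (f ∗ g) j    ∎

∗-sumTo : ∀ n f (g : ℕ → ℕ → ℕ) j →
  (f ∗ (λ l → sumTo n (λ i → g i l))) j ≡ sumTo n (λ i → (f ∗ g i) j)
∗-sumTo n f g j = trans (sumTo-cong j (λ l _ → sym (sumTo-*ˡ n (f l) (λ i → g i (j ∸ l)))))
  (sumTo-swap j n _)

zq^-suc : ∀ e A n k → zq^ e A (suc n) k ≡ shift e (A n) k
zq^-suc e A n k with e ≤? k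
... | yes e≤k = sym (shift-≤ e (A n) k e≤k)
... | no  e≰k = sym (shift-> e (A n) k e≰k)

zq^-shift : ∀ e A n b (f : ℕ → ℕ) → (∀ l → A n l ≡ shift b f l) →
  ∀ l → zq^ e A (suc n) l ≡ shift (e + b) f l
zq^-shift e A n b f Aₙ≡ l = begin
  zq^ e A (suc n) l      ≡⟨ zq^-suc e A n l ⟩
  shift e (A n) l        ≡⟨ shift-cong e Aₙ≡ l ⟩
  shift e (shift b f) l  ≡⟨ shift-+ e b f l ⟩
  shift (e + b) f l      ∎

-- Convergents of the continued fraction

pow-vanishes-below : ∀ X → (∀ k → X 0 k ≡ 0) → ∀ m n k → n < m → pow X m n k ≡ 0
pow-vanishes-below X X₀≡0 (suc m) n k (s≤s n≤m) =
  sumTo-zero n (λ i i≤n → sumTo-zero k (λ j _ → term i i≤n j))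
  where
  term : ∀ i → i ≤ n → ∀ j → X i j * pow X m (n ∸ i) (k ∸ j) ≡ 0
  term zero    _   j = cong (_* pow X m n (k ∸ j)) (X₀≡0 j)
  term (suc i) i<n j = trans
    (cong (X (suc i) j *_)
          (pow-vanishes-below X X₀≡0 m (n ∸ suc i) (k ∸ j) (<-≤-trans (∸-monoʳ-< z<s i<n) n≤m)))
    (*-zeroʳ (X (suc i) j))

geom-suc : ∀ X → (∀ k → X 0 k ≡ 0) → ∀ n k →
  geom X (suc n) k ≡ sumTo n (λ i → (X (suc i) ∗ geom X (n ∸ i)) k)
geom-suc X X₀≡0 n k = begin
  geom X (suc n) k
    ≡⟨ sumTo-suc n (λ m → pow X m (suc n) k) ⟩
  sumTo n (λ m → pow X (suc m) (suc n) k)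
    ≡⟨ sumTo-cong n (λ m _ → drop-X₀ m) ⟩
  sumTo n (λ m → sumTo n (λ i → (X (suc i) ∗ pow X m (n ∸ i)) k))
    ≡⟨ sumTo-swap n n _ ⟩
  sumTo n (λ i → sumTo n (λ m → (X (suc i) ∗ pow X m (n ∸ i)) k))
    ≡⟨ sumTo-cong n (λ i _ → sym (∗-sumTo n (X (suc i)) (λ m → pow X m (n ∸ i)) k)) ⟩
  sumTo n (λ i → (X (suc i) ∗ (λ l → sumTo n (λ m → pow X m (n ∸ i) l))) k)
    ≡⟨ sumTo-cong n (λ i _ → ∗-cong {f = X (suc i)} (λ _ → refl) (λ l →
         sumTo-truncate n (n ∸ i) _ (m∸n≤m n i) (λ m → pow-vanishes-below X X₀≡0 m (n ∸ i) l)) k) ⟩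
  sumTo n (λ i → (X (suc i) ∗ geom X (n ∸ i)) k)
    ∎
  where
  drop-X₀ : ∀ m → pow X (suc m) (suc n) k ≡ sumTo n (λ i → (X (suc i) ∗ pow X m (n ∸ i)) k)
  drop-X₀ m = trans (sumTo-suc n (λ i → (X i ∗ pow X m (suc n ∸ i)) k))
    (cong (_+ sumTo n (λ i → (X (suc i) ∗ pow X m (n ∸ i)) k))
          (sumTo-zero k (λ j _ → cong (_* pow X m (suc n) (k ∸ j)) (X₀≡0 j))))

geom-suc-shift : ∀ X → (∀ k → X 0 k ≡ 0) → ∀ e n (t : ℕ → ℕ → ℕ) →
  (∀ i → i ≤ n → ∀ k → (X (suc i) ∗ geom X (n ∸ i)) k ≡ shift e (t i) k) →
  ∀ k → geom X (suc n) k ≡ shift e (λ k → sumTo n (λ i → t i k)) k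
geom-suc-shift X X₀≡0 e n t term k = begin
  geom X (suc n) k                              ≡⟨ geom-suc X X₀≡0 n k ⟩
  sumTo n (λ i → (X (suc i) ∗ geom X (n ∸ i)) k) ≡⟨ sumTo-cong n (λ i i≤n → term i i≤n k) ⟩
  sumTo n (λ i → shift e (t i) k)                 ≡⟨ shift-sumTo e n t k ⟨
  shift e (λ k → sumTo n (λ i → t i k)) k        ∎

double : ℕ → ℕ
double zero    = zero
double (suc m) = suc (suc (double m))

half-double : ∀ m → half (double m) ≡ m
half-double zero    = refl
half-double (suc m) = cong suc (half-double m)

half-suc-double : ∀ m → half (suc (double m)) ≡ m
half-suc-double zero    = refl
half-suc-double (suc m) = cong suc (half-suc-double m)

convergent-z⁰ : ∀ d e k → convergent d e 0 k ≡ one 0 k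
convergent-z⁰ zero    e k = refl
convergent-z⁰ (suc d) e k = refl

*-split : ∀ m i n → i ≤ n → m * i + m * (n ∸ i) ≡ m * n
*-split m i n i≤n = trans (sym (*-distribˡ-+ m i (n ∸ i))) (cong (m *_) (m+[n∸m]≡n i≤n))

even-exponent : ∀ m i n → i ≤ n → m + m * i + m * (n ∸ i) ≡ m * suc n
even-exponent m i n i≤n = begin
  m + m * i + m * (n ∸ i)    ≡⟨ +-assoc m _ _ ⟩
  m + (m * i + m * (n ∸ i))  ≡⟨ cong (m +_) (*-split m i n i≤n) ⟩
  m + m * n                  ≡⟨ *-suc m n ⟨
  m * suc n                  ∎

odd-exponent : ∀ m i n → i ≤ n → m + suc m * i + m * (n ∸ i) ≡ m * suc n + i
odd-exponent m i n i≤n = begin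
  m + suc m * i + m * (n ∸ i)  ≡⟨ regroup m i (m * (n ∸ i)) ⟩
  m + m * i + m * (n ∸ i) + i  ≡⟨ cong (_+ i) (even-exponent m i n i≤n) ⟩
  m * suc n + i                ∎
  where
  open +-*-Solver
  regroup : ∀ m i x → m + suc m * i + x ≡ m + m * i + x + i
  regroup = solve 3 (λ m i x → m :+ (con 1 :+ m) :* i :+ x := m :+ m :* i :+ x :+ i) refl

module Convergents (P Q : Series)
  (P-zero : ∀ k → P 0 k ≡ one 0 k) (Q-zero : ∀ k → Q 0 k ≡ one 0 k)
  (P-suc : ∀ n k → P (suc n) k ≡ sumTo n (λ i → (Q i ∗ P (n ∸ i)) k))
  (Q-suc : ∀ n k → Q (suc n) k ≡ sumTo n (λ i → shift i (P i ∗ Q (n ∸ i)) k))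
  where

  -- The tail of the continued fraction from partial numerator 2m (resp. 2m+1) on is
  -- P (resp. Q) with z replaced by q^m z, and its z^n coefficient is final from depth n on.
  Settled : ℕ → Set
  Settled n = ∀ d → n ≤ d → ∀ m k →
    convergent d (double m) n k ≡ shift (m * n) (P n) k ×
    convergent d (suc (double m)) n k ≡ shift (m * n) (Q n) k

  settled-zero : Settled 0
  settled-zero d _ m k = tail P P-zero (double m) , tail Q Q-zero (suc (double m))
    where
    tail : ∀ R → (∀ k → R 0 k ≡ one 0 k) → ∀ e → convergent d e 0 k ≡ shift (m * 0) (R 0) k
    tail R R-zero e = begin
      convergent d e 0 k     ≡⟨ convergent-z⁰ d e k ⟩
      one 0 k                ≡⟨ R-zero k ⟨
      R 0 k                  ≡⟨ cong (λ a → shift a (R 0) k) (*-zeroʳ m) ⟨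
      shift (m * 0) (R 0) k  ∎

  SettledUpTo : ℕ → Set
  SettledUpTo n = ∀ i → i ≤ n → Settled i

  settled-suc-even : ∀ n d → SettledUpTo n → n ≤ d → ∀ m k →
    convergent (suc d) (double m) (suc n) k ≡ shift (m * suc n) (P (suc n)) k
  settled-suc-even n d ih n≤d m k = begin
    geom X (suc n) k
      ≡⟨ geom-suc-shift X (λ _ → refl) (m * suc n) n (λ i → Q i ∗ P (n ∸ i)) term k ⟩
    shift (m * suc n) (λ k → sumTo n (λ i → (Q i ∗ P (n ∸ i)) k)) k
      ≡⟨ shift-cong (m * suc n) (λ l → P-suc n l) k ⟨
    shift (m * suc n) (P (suc n)) k
      ∎
    where
    X = zq^ (half (double m)) (convergent d (suc (double m)))
    term : ∀ i → i ≤ n → ∀ k → (X (suc i) ∗ geom X (n ∸ i)) k ≡ shift (m * suc n) (Q i ∗ P (n ∸ i)) k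
    term i i≤n k = begin
      (X (suc i) ∗ geom X (n ∸ i)) k
        ≡⟨ ∗-cong numerator tail k ⟩
      (shift (m + m * i) (Q i) ∗ shift (m * (n ∸ i)) (P (n ∸ i))) k
        ≡⟨ ∗-shift (m + m * i) (m * (n ∸ i)) (Q i) (P (n ∸ i)) k ⟩
      shift (m + m * i + m * (n ∸ i)) (Q i ∗ P (n ∸ i)) k
        ≡⟨ cong (λ e → shift e (Q i ∗ P (n ∸ i)) k) (even-exponent m i n i≤n) ⟩
      shift (m * suc n) (Q i ∗ P (n ∸ i)) k
        ∎
      where
      numerator : ∀ l → X (suc i) l ≡ shift (m + m * i) (Q i) l
      numerator l = subst (λ e → X (suc i) l ≡ shift (e + m * i) (Q i) l) (half-double m)
        (zq^-shift (half (double m)) _ i (m * i) (Q i) (proj₂ ∘ ih i i≤n d (≤-trans i≤n n≤d) m) l)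
      tail : ∀ l → geom X (n ∸ i) l ≡ shift (m * (n ∸ i)) (P (n ∸ i)) l
      tail = proj₁ ∘ ih (n ∸ i) (m∸n≤m n i) (suc d) (≤-trans (m∸n≤m n i) (m≤n⇒m≤1+n n≤d)) m

  settled-suc-odd : ∀ n d → SettledUpTo n → n ≤ d → ∀ m k →
    convergent (suc d) (suc (double m)) (suc n) k ≡ shift (m * suc n) (Q (suc n)) k
  settled-suc-odd n d ih n≤d m k = begin
    geom X (suc n) k
      ≡⟨ geom-suc-shift X (λ _ → refl) (m * suc n) n (λ i → shift i (P i ∗ Q (n ∸ i))) term k ⟩
    shift (m * suc n) (λ k → sumTo n (λ i → shift i (P i ∗ Q (n ∸ i)) k)) k
      ≡⟨ shift-cong (m * suc n) (λ l → Q-suc n l) k ⟨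
    shift (m * suc n) (Q (suc n)) k
      ∎
    where
    X = zq^ (half (suc (double m))) (convergent d (double (suc m)))
    term : ∀ i → i ≤ n → ∀ k →
      (X (suc i) ∗ geom X (n ∸ i)) k ≡ shift (m * suc n) (shift i (P i ∗ Q (n ∸ i))) k
    term i i≤n k = begin
      (X (suc i) ∗ geom X (n ∸ i)) k
        ≡⟨ ∗-cong numerator tail k ⟩
      (shift (m + suc m * i) (P i) ∗ shift (m * (n ∸ i)) (Q (n ∸ i))) k
        ≡⟨ ∗-shift (m + suc m * i) (m * (n ∸ i)) (P i) (Q (n ∸ i)) k ⟩
      shift (m + suc m * i + m * (n ∸ i)) (P i ∗ Q (n ∸ i)) k
        ≡⟨ cong (λ e → shift e (P i ∗ Q (n ∸ i)) k) (odd-exponent m i n i≤n) ⟩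
      shift (m * suc n + i) (P i ∗ Q (n ∸ i)) k
        ≡⟨ shift-+ (m * suc n) i (P i ∗ Q (n ∸ i)) k ⟨
      shift (m * suc n) (shift i (P i ∗ Q (n ∸ i))) k
        ∎
      where
      numerator : ∀ l → X (suc i) l ≡ shift (m + suc m * i) (P i) l
      numerator l = subst (λ e → X (suc i) l ≡ shift (e + suc m * i) (P i) l) (half-suc-double m)
        (zq^-shift (half (suc (double m))) _ i (suc m * i) (P i)
                   (proj₁ ∘ ih i i≤n d (≤-trans i≤n n≤d) (suc m)) l)
      tail : ∀ l → geom X (n ∸ i) l ≡ shift (m * (n ∸ i)) (Q (n ∸ i)) l
      tail = proj₂ ∘ ih (n ∸ i) (m∸n≤m n i) (suc d) (≤-trans (m∸n≤m n i) (m≤n⇒m≤1+n n≤d)) m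

  settled : ∀ n → Settled n
  settled = <-rec Settled step
    where
    step : ∀ n → (∀ {i} → i < n → Settled i) → Settled n
    step zero    _  = settled-zero
    step (suc n) ih (suc d) (s≤s n≤d) m k =
      settled-suc-even n d ih′ n≤d m k , settled-suc-odd n d ih′ n≤d m k
      where
      ih′ : SettledUpTo n
      ih′ i i≤n = ih (s≤s i≤n)

  convergent-stabilises : ∀ n d → n ≤ d → ∀ k → convergent d 0 n k ≡ P n k
  convergent-stabilises n d n≤d k = proj₁ (settled n d n≤d 0 k)

⟦_⟧ : Bool → ℕ
⟦ true ⟧  = 1
⟦ false ⟧ = 0

⟦∧⟧ : ∀ x y → ⟦ x ∧ y ⟧ ≡ ⟦ x ⟧ * ⟦ y ⟧
⟦∧⟧ true  y = sym (+-identityʳ ⟦ y ⟧)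
⟦∧⟧ false y = refl

countᵇ : (ℕ → Bool) → List ℕ → ℕ
countᵇ p []       = 0
countᵇ p (x ∷ xs) = ⟦ p x ⟧ + countᵇ p xs

allBelow : ℕ → List ℕ → Bool
allBelow m = all (_<ᵇ m)

allWithin : ℕ → ℕ → List ℕ → Bool
allWithin c w = all (inWindow c w)

_∉ᵇ_ : ℕ → List ℕ → Bool
x ∉ᵇ []       = true
x ∉ᵇ (y ∷ ys) = not (x ≡ᵇ y) ∧ x ∉ᵇ ys

uniqueᵇ : List ℕ → Bool
uniqueᵇ []       = true
uniqueᵇ (x ∷ xs) = x ∉ᵇ xs ∧ uniqueᵇ xs

-- No occurrence of 2-3-1 in a ∷ v uses the head a as its 2.
avoids231From : ℕ → List ℕ → Bool
avoids231From a []      = true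
avoids231From a (b ∷ v) = (if a <ᵇ b then all (a ≤ᵇ_) v else true) ∧ avoids231From a v

avoids231ᵇ : List ℕ → Bool
avoids231ᵇ []      = true
avoids231ᵇ (a ∷ v) = avoids231From a v ∧ avoids231ᵇ v

-- The number of occurrences of 31-2 in a ∷ v that use the head a as their 3.
occ31-2From : ℕ → List ℕ → ℕ
occ31-2From a []      = 0
occ31-2From a (b ∷ u) = countᵇ (λ c → (b <ᵇ c) ∧ (c <ᵇ a)) u

stat31-2ᵇ : List ℕ → ℕ
stat31-2ᵇ []      = 0
stat31-2ᵇ (a ∷ v) = occ31-2From a v + stat31-2ᵇ v

aboveHead : List ℕ → ℕ
aboveHead []      = 0
aboveHead (a ∷ u) = countᵇ (a <ᵇ_) u

avoiding : (List ℕ → ℕ) → List ℕ → ℕ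
avoiding X w = ⟦ uniqueᵇ w ⟧ * (⟦ avoids231ᵇ w ⟧ * X w)

-- The monomial q^x.
δ : ℕ → ℕ → ℕ
δ x j = ⟦ x ≡ᵇ j ⟧

weightF : ℕ → List ℕ → ℕ
weightF k = avoiding (λ w → δ (stat31-2ᵇ w) k)

weightG : ℕ → List ℕ → ℕ
weightG k = avoiding (λ w → δ (stat31-2ᵇ w + aboveHead w) k)

all-++ : ∀ (p : ℕ → Bool) xs ys → all p (xs ++ ys) ≡ (all p xs ∧ all p ys)
all-++ p []       ys = refl
all-++ p (x ∷ xs) ys = trans (cong (p x ∧_) (all-++ p xs ys)) (sym (∧-assoc (p x) _ _))

all-map : ∀ (p : ℕ → Bool) (f : ℕ → ℕ) xs → all p (map f xs) ≡ all (p ∘ f) xs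
all-map p f []       = refl
all-map p f (x ∷ xs) = cong (p (f x) ∧_) (all-map p f xs)

all-cong : ∀ {p q : ℕ → Bool} → (∀ x → p x ≡ q x) → ∀ xs → all p xs ≡ all q xs
all-cong p≡q []       = refl
all-cong p≡q (x ∷ xs) = cong₂ _∧_ (p≡q x) (all-cong p≡q xs)

all-mono : ∀ {p q : ℕ → Bool} → (∀ x → p x ≡ true → q x ≡ true) →
  ∀ xs → all p xs ≡ true → all q xs ≡ true
all-mono p⇒q []       _  = refl
all-mono p⇒q (x ∷ xs) eq with ∧≡true⇒× eq
... | px , pxs = cong₂ _∧_ (p⇒q x px) (all-mono p⇒q xs pxs)

all-mono₂ : ∀ {p q r : ℕ → Bool} → (∀ x → p x ≡ true → q x ≡ true → r x ≡ true) →
  ∀ xs → all p xs ≡ true → all q xs ≡ true → all r xs ≡ true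
all-mono₂ pq⇒r []       _   _   = refl
all-mono₂ pq⇒r (x ∷ xs) eqp eqq with ∧≡true⇒× eqp | ∧≡true⇒× eqq
... | px , pxs | qx , qxs = cong₂ _∧_ (pq⇒r x px qx) (all-mono₂ pq⇒r xs pxs qxs)

all-const : ∀ (xs : List ℕ) → all (λ _ → true) xs ≡ true
all-const []       = refl
all-const (_ ∷ xs) = all-const xs

countᵇ-++ : ∀ p xs ys → countᵇ p (xs ++ ys) ≡ countᵇ p xs + countᵇ p ys
countᵇ-++ p []       ys = refl
countᵇ-++ p (x ∷ xs) ys = trans (cong (⟦ p x ⟧ +_) (countᵇ-++ p xs ys)) (sym (+-assoc ⟦ p x ⟧ _ _))

countᵇ-map : ∀ p f xs → countᵇ p (map f xs) ≡ countᵇ (p ∘ f) xs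
countᵇ-map p f []       = refl
countᵇ-map p f (x ∷ xs) = cong (⟦ p (f x) ⟧ +_) (countᵇ-map p f xs)

countᵇ-cong : ∀ {r p q : ℕ → Bool} → (∀ x → r x ≡ true → p x ≡ q x) →
  ∀ xs → all r xs ≡ true → countᵇ p xs ≡ countᵇ q xs
countᵇ-cong p≡q []       _  = refl
countᵇ-cong p≡q (x ∷ xs) eq with ∧≡true⇒× eq
... | rx , rxs = cong₂ _+_ (cong ⟦_⟧ (p≡q x rx)) (countᵇ-cong p≡q xs rxs)

countᵇ-none : ∀ p xs → all (not ∘ p) xs ≡ true → countᵇ p xs ≡ 0
countᵇ-none p []       _  = refl
countᵇ-none p (x ∷ xs) eq with p x
... | false = countᵇ-none p xs eq

countᵇ-all : ∀ p xs → all p xs ≡ true → countᵇ p xs ≡ length xs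
countᵇ-all p []       _  = refl
countᵇ-all p (x ∷ xs) eq with p x
... | true = cong suc (countᵇ-all p xs eq)

∉ᵇ-++ : ∀ x xs ys → x ∉ᵇ (xs ++ ys) ≡ (x ∉ᵇ xs ∧ x ∉ᵇ ys)
∉ᵇ-++ x []       ys = refl
∉ᵇ-++ x (y ∷ xs) ys =
  trans (cong (not (x ≡ᵇ y) ∧_) (∉ᵇ-++ x xs ys)) (sym (∧-assoc (not (x ≡ᵇ y)) _ _))

∉ᵇ-+ˡ : ∀ c x xs → (c + x) ∉ᵇ map (c +_) xs ≡ x ∉ᵇ xs
∉ᵇ-+ˡ c x []       = refl
∉ᵇ-+ˡ c x (y ∷ xs) = cong₂ _∧_ (cong not (≡ᵇ-+ˡ c x y)) (∉ᵇ-+ˡ c x xs)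

∉ᵇ⇔all : ∀ x xs → x ∉ᵇ xs ≡ all (λ y → not (x ≡ᵇ y)) xs
∉ᵇ⇔all x []       = refl
∉ᵇ⇔all x (y ∷ xs) = cong (not (x ≡ᵇ y) ∧_) (∉ᵇ⇔all x xs)

∉ᵇ-excluded : ∀ {p : ℕ → Bool} x ys → (∀ y → p y ≡ true → x ≢ y) →
  all p ys ≡ true → x ∉ᵇ ys ≡ true
∉ᵇ-excluded x ys x∉p eq =
  trans (∉ᵇ⇔all x ys) (all-mono (λ y py → cong not (≢⇒≡ᵇ≡false (x∉p y py))) ys eq)

uniqueᵇ-++ : ∀ xs ys → all (_∉ᵇ ys) xs ≡ true → uniqueᵇ (xs ++ ys) ≡ (uniqueᵇ xs ∧ uniqueᵇ ys)
uniqueᵇ-++ []       ys _  = refl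
uniqueᵇ-++ (x ∷ xs) ys eq with ∧≡true⇒× eq
... | x∉ys , xs∉ys = begin
  x ∉ᵇ (xs ++ ys) ∧ uniqueᵇ (xs ++ ys)
    ≡⟨ cong₂ _∧_ (trans (∉ᵇ-++ x xs ys) (trans (cong (x ∉ᵇ xs ∧_) x∉ys) (∧-identityʳ _)))
                 (uniqueᵇ-++ xs ys xs∉ys) ⟩
  x ∉ᵇ xs ∧ (uniqueᵇ xs ∧ uniqueᵇ ys)
    ≡⟨ ∧-assoc (x ∉ᵇ xs) _ _ ⟨
  (x ∉ᵇ xs ∧ uniqueᵇ xs) ∧ uniqueᵇ ys
    ∎

uniqueᵇ-+ˡ : ∀ c xs → uniqueᵇ (map (c +_) xs) ≡ uniqueᵇ xs
uniqueᵇ-+ˡ c []       = refl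
uniqueᵇ-+ˡ c (x ∷ xs) = cong₂ _∧_ (∉ᵇ-+ˡ c x xs) (uniqueᵇ-+ˡ c xs)

avoids231From-≥ : ∀ a ys → all (a ≤ᵇ_) ys ≡ true → avoids231From a ys ≡ true
avoids231From-≥ a []       _  = refl
avoids231From-≥ a (y ∷ ys) eq with ∧≡true⇒× eq
... | _ , a≤ys with a <ᵇ y
... | true  = cong₂ _∧_ a≤ys (avoids231From-≥ a ys a≤ys)
... | false = avoids231From-≥ a ys a≤ys

avoids231From-< : ∀ a xs → allBelow a xs ≡ true → avoids231From a xs ≡ true
avoids231From-< a []       _  = refl
avoids231From-< a (x ∷ xs) eq with ∧≡true⇒× eq
... | x<a , xs<a with a <ᵇ x in a<x
... | true  = ⊥-elim (<-asym (<ᵇ≡true⇒< x a x<a) (<ᵇ≡true⇒< a x a<x))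
... | false = avoids231From-< a xs xs<a

avoids231From-++ : ∀ a xs ys → all (a ≤ᵇ_) ys ≡ true → avoids231From a (xs ++ ys) ≡ avoids231From a xs
avoids231From-++ a []       ys a≤ys = avoids231From-≥ a ys a≤ys
avoids231From-++ a (x ∷ xs) ys a≤ys with a <ᵇ x
... | true  = cong₂ _∧_
  (trans (all-++ (a ≤ᵇ_) xs ys) (trans (cong (all (a ≤ᵇ_) xs ∧_) a≤ys) (∧-identityʳ _)))
  (avoids231From-++ a xs ys a≤ys)
... | false = avoids231From-++ a xs ys a≤ys

avoids231From-+ˡ : ∀ c a xs → avoids231From (c + a) (map (c +_) xs) ≡ avoids231From a xs
avoids231From-+ˡ c a []       = refl
avoids231From-+ˡ c a (x ∷ xs)
  rewrite <ᵇ-+ˡ c a x | all-map ((c + a) ≤ᵇ_) (c +_) xs | all-cong (≤ᵇ-+ˡ c a) xs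
        | avoids231From-+ˡ c a xs = refl

avoids231ᵇ-++ : ∀ xs ys → all (λ x → all (x ≤ᵇ_) ys) xs ≡ true →
  avoids231ᵇ (xs ++ ys) ≡ (avoids231ᵇ xs ∧ avoids231ᵇ ys)
avoids231ᵇ-++ []       ys _  = refl
avoids231ᵇ-++ (x ∷ xs) ys eq with ∧≡true⇒× eq
... | x≤ys , xs≤ys = trans (cong₂ _∧_ (avoids231From-++ x xs ys x≤ys) (avoids231ᵇ-++ xs ys xs≤ys))
                           (sym (∧-assoc (avoids231From x xs) _ _))

avoids231ᵇ-+ˡ : ∀ c xs → avoids231ᵇ (map (c +_) xs) ≡ avoids231ᵇ xs
avoids231ᵇ-+ˡ c []       = refl
avoids231ᵇ-+ˡ c (x ∷ xs) = cong₂ _∧_ (avoids231From-+ˡ c x xs) (avoids231ᵇ-+ˡ c xs)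

countᵇ-between-≥ : ∀ a y zs → all (a ≤ᵇ_) zs ≡ true →
  countᵇ (λ z → (y <ᵇ z) ∧ (z <ᵇ a)) zs ≡ 0
countᵇ-between-≥ a y zs a≤zs = countᵇ-none _ zs (all-mono outside zs a≤zs)
  where
  outside : ∀ z → (a ≤ᵇ z) ≡ true → not ((y <ᵇ z) ∧ (z <ᵇ a)) ≡ true
  outside z a≤z with z <ᵇ a in z<a
  ... | true  = ⊥-elim (<⇒≱ (<ᵇ≡true⇒< z a z<a) (≤ᵇ≡true⇒≤ a z a≤z))
  ... | false = cong not (∧-zeroʳ (y <ᵇ z))

occ31-2From-++ : ∀ a xs ys → all (a ≤ᵇ_) ys ≡ true → occ31-2From a (xs ++ ys) ≡ occ31-2From a xs
occ31-2From-++ a []       []       _     = refl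
occ31-2From-++ a []       (y ∷ ys) a≤ys = countᵇ-between-≥ a y ys (proj₂ (∧≡true⇒× a≤ys))
occ31-2From-++ a (x ∷ xs) ys       a≤ys = begin
  countᵇ between (xs ++ ys)
    ≡⟨ countᵇ-++ between xs ys ⟩
  countᵇ between xs + countᵇ between ys
    ≡⟨ cong (countᵇ between xs +_) (countᵇ-between-≥ a x ys a≤ys) ⟩
  countᵇ between xs + 0
    ≡⟨ +-identityʳ _ ⟩
  countᵇ between xs
    ∎
  where between = λ z → (x <ᵇ z) ∧ (z <ᵇ a)

occ31-2From-+ˡ : ∀ c a xs → occ31-2From (c + a) (map (c +_) xs) ≡ occ31-2From a xs
occ31-2From-+ˡ c a []       = refl
occ31-2From-+ˡ c a (y ∷ xs) = trans (countᵇ-map _ (c +_) xs)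
  (countᵇ-cong {r = λ _ → true} (λ z _ → cong₂ _∧_ (<ᵇ-+ˡ c y z) (<ᵇ-+ˡ c z a)) xs (all-const xs))

occ31-2From-< : ∀ a xs → allBelow a xs ≡ true → occ31-2From a xs ≡ aboveHead xs
occ31-2From-< a []       _    = refl
occ31-2From-< a (x ∷ xs) xs<a =
  countᵇ-cong (λ z z<a → trans (cong ((x <ᵇ z) ∧_) z<a) (∧-identityʳ _)) xs (proj₂ (∧≡true⇒× xs<a))

stat31-2ᵇ-++ : ∀ xs ys → all (λ x → all (x ≤ᵇ_) ys) xs ≡ true →
  stat31-2ᵇ (xs ++ ys) ≡ stat31-2ᵇ xs + stat31-2ᵇ ys
stat31-2ᵇ-++ []       ys _  = refl
stat31-2ᵇ-++ (x ∷ xs) ys eq with ∧≡true⇒× eq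
... | x≤ys , xs≤ys = trans (cong₂ _+_ (occ31-2From-++ x xs ys x≤ys) (stat31-2ᵇ-++ xs ys xs≤ys))
                           (sym (+-assoc (occ31-2From x xs) _ _))

stat31-2ᵇ-+ˡ : ∀ c xs → stat31-2ᵇ (map (c +_) xs) ≡ stat31-2ᵇ xs
stat31-2ᵇ-+ˡ c []       = refl
stat31-2ᵇ-+ˡ c (x ∷ xs) = cong₂ _+_ (occ31-2From-+ˡ c x xs) (stat31-2ᵇ-+ˡ c xs)

-- The pigeonhole principle

length-filterᵇ : ∀ p xs → length (filterᵇ p xs) ≡ countᵇ p xs
length-filterᵇ p []       = refl
length-filterᵇ p (x ∷ xs) with p x
... | true  = cong suc (length-filterᵇ p xs)
... | false = length-filterᵇ p xs

∉ᵇ-filterᵇ : ∀ p y xs → y ∉ᵇ xs ≡ true → y ∉ᵇ filterᵇ p xs ≡ true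
∉ᵇ-filterᵇ p y []       _  = refl
∉ᵇ-filterᵇ p y (x ∷ xs) eq with ∧≡true⇒× eq
... | y≢x , y∉xs with p x
... | true  = cong₂ _∧_ y≢x (∉ᵇ-filterᵇ p y xs y∉xs)
... | false = ∉ᵇ-filterᵇ p y xs y∉xs

uniqueᵇ-filterᵇ : ∀ p xs → uniqueᵇ xs ≡ true → uniqueᵇ (filterᵇ p xs) ≡ true
uniqueᵇ-filterᵇ p []       _  = refl
uniqueᵇ-filterᵇ p (x ∷ xs) eq with ∧≡true⇒× eq
... | x∉xs , u with p x
... | true  = cong₂ _∧_ (∉ᵇ-filterᵇ p x xs x∉xs) (uniqueᵇ-filterᵇ p xs u)
... | false = uniqueᵇ-filterᵇ p xs u

all-filterᵇ : ∀ (p : ℕ → Bool) xs → all p (filterᵇ p xs) ≡ true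
all-filterᵇ p []       = refl
all-filterᵇ p (x ∷ xs) with p x in px
... | true  = cong₂ _∧_ px (all-filterᵇ p xs)
... | false = all-filterᵇ p xs

filterᵇ-all : ∀ (p q : ℕ → Bool) xs → all q xs ≡ true → all q (filterᵇ p xs) ≡ true
filterᵇ-all p q []       _  = refl
filterᵇ-all p q (x ∷ xs) eq with ∧≡true⇒× eq
... | qx , qxs with p x
... | true  = cong₂ _∧_ qx (filterᵇ-all p q xs qxs)
... | false = filterᵇ-all p q xs qxs

remove : ℕ → List ℕ → List ℕ
remove c []       = []
remove c (x ∷ xs) = if c ≡ᵇ x then xs else x ∷ remove c xs

remove-length : ∀ c xs → c ∉ᵇ xs ≡ false → length xs ≡ suc (length (remove c xs))
remove-length c (x ∷ xs) c∈ with c ≡ᵇ x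
... | true  = refl
... | false = cong suc (remove-length c xs c∈)

remove-all : ∀ (q : ℕ → Bool) c xs → all q xs ≡ true → all q (remove c xs) ≡ true
remove-all q c []       _  = refl
remove-all q c (x ∷ xs) eq with ∧≡true⇒× eq
... | qx , qxs with c ≡ᵇ x
... | true  = qxs
... | false = cong₂ _∧_ qx (remove-all q c xs qxs)

∉ᵇ-remove : ∀ y c xs → y ∉ᵇ xs ≡ true → y ∉ᵇ remove c xs ≡ true
∉ᵇ-remove y c []       _  = refl
∉ᵇ-remove y c (x ∷ xs) eq with ∧≡true⇒× eq
... | y≢x , y∉xs with c ≡ᵇ x
... | true  = y∉xs
... | false = cong₂ _∧_ y≢x (∉ᵇ-remove y c xs y∉xs)

uniqueᵇ-remove : ∀ c xs → uniqueᵇ xs ≡ true → uniqueᵇ (remove c xs) ≡ true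
uniqueᵇ-remove c []       _  = refl
uniqueᵇ-remove c (x ∷ xs) eq with ∧≡true⇒× eq
... | x∉xs , u with c ≡ᵇ x
... | true  = u
... | false = cong₂ _∧_ (∉ᵇ-remove x c xs x∉xs) (uniqueᵇ-remove c xs u)

remove-∉ᵇ : ∀ c xs → uniqueᵇ xs ≡ true → c ∉ᵇ remove c xs ≡ true
remove-∉ᵇ c []       _  = refl
remove-∉ᵇ c (x ∷ xs) eq with ∧≡true⇒× eq
... | x∉xs , u with c ≡ᵇ x in c≡x
... | true  = subst (λ y → y ∉ᵇ xs ≡ true) (sym (≡ᵇ≡true⇒≡ c x c≡x)) x∉xs
... | false = cong₂ _∧_ (cong not c≡x) (remove-∉ᵇ c xs u)

allWithin-suc : ∀ c m xs → allWithin c (suc m) xs ≡ true → c ∉ᵇ xs ≡ true → allWithin (suc c) m xs ≡ true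
allWithin-suc c m xs within c∉xs = all-mono₂ narrow xs within (trans (sym (∉ᵇ⇔all c xs)) c∉xs)
  where
  narrow : ∀ x → inWindow c (suc m) x ≡ true → not (c ≡ᵇ x) ≡ true → inWindow (suc c) m x ≡ true
  narrow x x∈ c≢x with ∧≡true⇒× x∈
  ... | c≤x , x<c+1+m = cong₂ _∧_ (≤⇒≤ᵇ≡true (≤∧≢⇒< (≤ᵇ≡true⇒≤ c x c≤x) (not-≡ᵇ⇒≢ c x c≢x)))
                                  (<⇒<ᵇ≡true (subst (x <_) (+-suc c m) (<ᵇ≡true⇒< x _ x<c+1+m)))

uniqueᵇ-within⇒length≤ : ∀ m c xs → uniqueᵇ xs ≡ true → allWithin c m xs ≡ true → length xs ≤ m
uniqueᵇ-within⇒length≤ zero    c []       _ _      = z≤n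
uniqueᵇ-within⇒length≤ zero    c (x ∷ xs) _ within with ∧≡true⇒× (proj₁ (∧≡true⇒× within))
... | c≤x , x<c+0 =
  ⊥-elim (<⇒≱ (<ᵇ≡true⇒< x (c + 0) x<c+0) (subst (_≤ x) (sym (+-identityʳ c)) (≤ᵇ≡true⇒≤ c x c≤x)))
uniqueᵇ-within⇒length≤ (suc m) c xs u within with c ∉ᵇ xs in c∉xs
... | true  = m≤n⇒m≤1+n (uniqueᵇ-within⇒length≤ m (suc c) xs u (allWithin-suc c m xs within c∉xs))
... | false = subst (_≤ suc m) (sym (remove-length c xs c∉xs))
  (s≤s (uniqueᵇ-within⇒length≤ m (suc c) (remove c xs) (uniqueᵇ-remove c xs u)
         (allWithin-suc c m (remove c xs) (remove-all _ c xs within) (remove-∉ᵇ c xs u))))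

sumWords : ℕ → ℕ → (List ℕ → ℕ) → ℕ
sumWords zero    m g = g []
sumWords (suc n) m g = sumBelow m (λ x → sumWords n m (λ v → g (x ∷ v)))

F G : Series
F n k = sumWords n n (weightF k)
G n k = sumWords n n (weightG k)

sumWords-cong : ∀ n m {g g′ : List ℕ → ℕ} → (∀ v → length v ≡ n → allBelow m v ≡ true → g v ≡ g′ v) →
  sumWords n m g ≡ sumWords n m g′
sumWords-cong zero    m g≡g′ = g≡g′ [] refl refl
sumWords-cong (suc n) m g≡g′ = sumBelow-cong m (λ x x<m → sumWords-cong n m (λ v |v| v<m →
  g≡g′ (x ∷ v) (cong suc |v|) (cong₂ _∧_ (<⇒<ᵇ≡true x<m) v<m)))

sumWords-zero : ∀ n m {g : List ℕ → ℕ} → (∀ v → length v ≡ n → allBelow m v ≡ true → g v ≡ 0) →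
  sumWords n m g ≡ 0
sumWords-zero zero    m g≡0 = g≡0 [] refl refl
sumWords-zero (suc n) m g≡0 = sumBelow-zero m (λ x x<m → sumWords-zero n m (λ v |v| v<m →
  g≡0 (x ∷ v) (cong suc |v|) (cong₂ _∧_ (<⇒<ᵇ≡true x<m) v<m)))

sumWords-sumTo : ∀ n m k (f : List ℕ → ℕ → ℕ) →
  sumWords n m (λ v → sumTo k (f v)) ≡ sumTo k (λ j → sumWords n m (λ v → f v j))
sumWords-sumTo zero    m k f = refl
sumWords-sumTo (suc n) m k f = trans (sumBelow-cong m (λ x _ → sumWords-sumTo n m k (λ v → f (x ∷ v))))
  (sumBelow-sumTo m k (λ x j → sumWords n m (λ v → f (x ∷ v) j)))

sumWords-*ˡ : ∀ n m c (g : List ℕ → ℕ) → sumWords n m (λ v → c * g v) ≡ c * sumWords n m g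
sumWords-*ˡ zero    m c g = refl
sumWords-*ˡ (suc n) m c g = trans (sumBelow-cong m (λ x _ → sumWords-*ˡ n m c (λ v → g (x ∷ v))))
  (sumBelow-*ˡ m c (λ x → sumWords n m (λ v → g (x ∷ v))))

sumWords-*ʳ : ∀ n m c (g : List ℕ → ℕ) → sumWords n m (λ v → g v * c) ≡ sumWords n m g * c
sumWords-*ʳ n m c g = begin
  sumWords n m (λ v → g v * c)  ≡⟨ sumWords-cong n m (λ v _ _ → *-comm (g v) c) ⟩
  sumWords n m (λ v → c * g v)  ≡⟨ sumWords-*ˡ n m c g ⟩
  c * sumWords n m g            ≡⟨ *-comm c _ ⟩
  sumWords n m g * c            ∎

sumWords-* : ∀ a m b m′ (f g : List ℕ → ℕ) →
  sumWords a m (λ L → sumWords b m′ (λ R → f L * g R)) ≡ sumWords a m f * sumWords b m′ g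
sumWords-* a m b m′ f g =
  trans (sumWords-cong a m (λ L _ _ → sumWords-*ˡ b m′ (f L) g)) (sumWords-*ʳ a m (sumWords b m′ g) f)

sumWords-++ : ∀ a b m (g : List ℕ → ℕ) →
  sumWords (a + b) m g ≡ sumWords a m (λ L → sumWords b m (λ R → g (L ++ R)))
sumWords-++ zero    b m g = refl
sumWords-++ (suc a) b m g = sumBelow-cong m (λ x _ → sumWords-++ a b m (λ v → g (x ∷ v)))

sumWords-window : ∀ n c w m (g : List ℕ → ℕ) → c + w ≤ m →
  (∀ v → length v ≡ n → allBelow m v ≡ true → allWithin c w v ≡ false → g v ≡ 0) →
  sumWords n m g ≡ sumWords n w (λ v → g (map (c +_) v))
sumWords-window zero    c w m g c+w≤m g≡0 = refl
sumWords-window (suc n) c w m g c+w≤m g≡0 = trans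
  (sumBelow-window c w m _ c+w≤m (λ x x<m x∉ → sumWords-zero n m (λ v |v| v<m →
    g≡0 (x ∷ v) (cong suc |v|) (cong₂ _∧_ (<⇒<ᵇ≡true x<m) v<m) (cong (_∧ allWithin c w v) x∉))))
  (sumBelow-cong w (λ y y<w → sumWords-window n c w m (λ v → g ((c + y) ∷ v)) c+w≤m (λ v |v| v<m v∉ →
    g≡0 (c + y ∷ v) (cong suc |v|) (cong₂ _∧_ (<⇒<ᵇ≡true (<-≤-trans (+-monoʳ-< c y<w) c+w≤m)) v<m)
        (cong₂ _∧_ (cong₂ _∧_ (≤⇒≤ᵇ≡true (m≤m+n c y)) (<⇒<ᵇ≡true (+-monoʳ-< c y<w))) v∉))))

sumWords-shift : ∀ n m b (g : ℕ → List ℕ → ℕ) t →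
  sumWords n m (λ v → shift b (λ y → g y v) t) ≡ shift b (λ y → sumWords n m (g y)) t
sumWords-shift n m b g t with b ≤? t
... | yes b≤t = trans (sumWords-cong n m (λ v _ _ → shift-≤ b _ t b≤t)) (sym (shift-≤ b _ t b≤t))
... | no  b≰t = trans (sumWords-zero n m (λ v _ _ → shift-> b _ t b≰t)) (sym (shift-> b _ t b≰t))

sumWords-∗ : ∀ a m b m′ (f g : List ℕ → ℕ → ℕ) k →
  sumWords a m (λ L → sumWords b m′ (λ R → (f L ∗ g R) k)) ≡
  ((λ j → sumWords a m (λ L → f L j)) ∗ (λ j → sumWords b m′ (λ R → g R j))) k
sumWords-∗ a m b m′ f g k = begin
  sumWords a m (λ L → sumWords b m′ (λ R → sumTo k (λ j → f L j * g R (k ∸ j))))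
    ≡⟨ sumWords-cong a m (λ L _ _ → sumWords-sumTo b m′ k _) ⟩
  sumWords a m (λ L → sumTo k (λ j → sumWords b m′ (λ R → f L j * g R (k ∸ j))))
    ≡⟨ sumWords-sumTo a m k _ ⟩
  sumTo k (λ j → sumWords a m (λ L → sumWords b m′ (λ R → f L j * g R (k ∸ j))))
    ≡⟨ sumTo-cong k (λ j _ → sumWords-* a m b m′ (λ L → f L j) (λ R → g R (k ∸ j))) ⟩
  sumTo k (λ j → sumWords a m (λ L → f L j) * sumWords b m′ (λ R → g R (k ∸ j)))
    ∎

δ-+ : ∀ x y k → δ (x + y) k ≡ (δ x ∗ δ y) k
δ-+ x y k with x ≤? k
... | yes x≤k = sym (begin
  sumTo k (λ j → δ x j * δ y (k ∸ j))
    ≡⟨ sumTo-single k x _ x≤k (λ j _ j≢x → cong (λ b → ⟦ b ⟧ * δ y (k ∸ j)) (≢⇒≡ᵇ≡false (j≢x ∘ sym))) ⟩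
  δ x x * δ y (k ∸ x)
    ≡⟨ cong (λ b → ⟦ b ⟧ * δ y (k ∸ x)) (≡⇒≡ᵇ≡true {x} refl) ⟩
  δ y (k ∸ x) + 0
    ≡⟨ +-identityʳ _ ⟩
  δ y (k ∸ x)
    ≡⟨ cong ⟦_⟧ (≡-by-≡true to from) ⟩
  δ (x + y) k
    ∎)
  where
  to : (y ≡ᵇ k ∸ x) ≡ true → (x + y ≡ᵇ k) ≡ true
  to eq = ≡⇒≡ᵇ≡true (trans (cong (x +_) (≡ᵇ≡true⇒≡ y _ eq)) (m+[n∸m]≡n x≤k))
  from : (x + y ≡ᵇ k) ≡ true → (y ≡ᵇ k ∸ x) ≡ true
  from eq = ≡⇒≡ᵇ≡true (trans (sym (m+n∸m≡n x y)) (cong (_∸ x) (≡ᵇ≡true⇒≡ _ k eq)))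
... | no  x≰k = trans (cong ⟦_⟧ (≢⇒≡ᵇ≡false (λ x+y≡k → x≰k (subst (x ≤_) x+y≡k (m≤m+n x y)))))
  (sym (sumTo-zero k (λ j j≤k →
    cong (λ b → ⟦ b ⟧ * δ y (k ∸ j)) (≢⇒≡ᵇ≡false (λ x≡j → x≰k (subst (_≤ k) (sym x≡j) j≤k))))))

δ-shift : ∀ s b t → δ (s + b) t ≡ shift b (δ s) t
δ-shift s b t with b ≤? t
... | yes b≤t = trans (cong ⟦_⟧ (≡-by-≡true to from)) (sym (shift-≤ b _ t b≤t))
  where
  to : (s + b ≡ᵇ t) ≡ true → (s ≡ᵇ t ∸ b) ≡ true
  to eq = ≡⇒≡ᵇ≡true (trans (sym (m+n∸n≡m s b)) (cong (_∸ b) (≡ᵇ≡true⇒≡ _ t eq)))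
  from : (s ≡ᵇ t ∸ b) ≡ true → (s + b ≡ᵇ t) ≡ true
  from eq = ≡⇒≡ᵇ≡true (trans (cong (_+ b) (≡ᵇ≡true⇒≡ s _ eq)) (m∸n+n≡m b≤t))
... | no  b≰t = trans (cong ⟦_⟧ (≢⇒≡ᵇ≡false (λ s+b≡t → b≰t (subst (b ≤_) s+b≡t (m≤n+m b s)))))
                      (sym (shift-> b _ t b≰t))

avoiding-split : ∀ u₁ u₂ a₁ a₂ x y k →
  ⟦ u₁ ∧ u₂ ⟧ * (⟦ a₁ ∧ a₂ ⟧ * δ (x + y) k) ≡
  ((λ j → ⟦ u₁ ⟧ * (⟦ a₁ ⟧ * δ x j)) ∗ (λ j → ⟦ u₂ ⟧ * (⟦ a₂ ⟧ * δ y j))) k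
avoiding-split u₁ u₂ a₁ a₂ x y k = begin
  ⟦ u₁ ∧ u₂ ⟧ * (⟦ a₁ ∧ a₂ ⟧ * δ (x + y) k)
    ≡⟨ cong₂ (λ p q → p * (q * δ (x + y) k)) (⟦∧⟧ u₁ u₂) (⟦∧⟧ a₁ a₂) ⟩
  ⟦ u₁ ⟧ * ⟦ u₂ ⟧ * (⟦ a₁ ⟧ * ⟦ a₂ ⟧ * δ (x + y) k)
    ≡⟨ cong (λ z → ⟦ u₁ ⟧ * ⟦ u₂ ⟧ * (⟦ a₁ ⟧ * ⟦ a₂ ⟧ * z)) (δ-+ x y k) ⟩
  ⟦ u₁ ⟧ * ⟦ u₂ ⟧ * (⟦ a₁ ⟧ * ⟦ a₂ ⟧ * sumTo k (λ j → δ x j * δ y (k ∸ j)))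
    ≡⟨ cong (⟦ u₁ ⟧ * ⟦ u₂ ⟧ *_) (sumTo-*ˡ k (⟦ a₁ ⟧ * ⟦ a₂ ⟧) _) ⟨
  ⟦ u₁ ⟧ * ⟦ u₂ ⟧ * sumTo k (λ j → ⟦ a₁ ⟧ * ⟦ a₂ ⟧ * (δ x j * δ y (k ∸ j)))
    ≡⟨ sumTo-*ˡ k (⟦ u₁ ⟧ * ⟦ u₂ ⟧) _ ⟨
  sumTo k (λ j → ⟦ u₁ ⟧ * ⟦ u₂ ⟧ * (⟦ a₁ ⟧ * ⟦ a₂ ⟧ * (δ x j * δ y (k ∸ j))))
    ≡⟨ sumTo-cong k (λ j _ → regroup ⟦ u₁ ⟧ ⟦ u₂ ⟧ ⟦ a₁ ⟧ ⟦ a₂ ⟧ (δ x j) (δ y (k ∸ j))) ⟩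
  sumTo k (λ j → (⟦ u₁ ⟧ * (⟦ a₁ ⟧ * δ x j)) * (⟦ u₂ ⟧ * (⟦ a₂ ⟧ * δ y (k ∸ j))))
    ∎
  where
  regroup : ∀ p q r s t w → p * q * (r * s * (t * w)) ≡ (p * (r * t)) * (q * (s * w))
  regroup = +-*-Solver.solve 6
    (λ p q r s t w → p :* q :* (r :* s :* (t :* w)) := (p :* (r :* t)) :* (q :* (s :* w))) refl
    where open +-*-Solver using (_:*_; _:=_)

-- Decomposition at the first entry

large-before⇒many-large : ∀ a L R → avoids231From a (L ++ R) ≡ true → a ∉ᵇ (L ++ R) ≡ true →
  allBelow a L ≡ false → suc (length R) ≤ countᵇ (a <ᵇ_) (L ++ R)
large-before⇒many-large a (x ∷ L) R avoids a∉ L≮a with ∧≡true⇒× {not (a ≡ᵇ x)} a∉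
... | a≢x , a∉L++R with a <ᵇ x in a<x
... | true  = s≤s (≤-trans (m≤n+m (length R) (length L))
  (≤-reflexive (sym (trans (countᵇ-all (a <ᵇ_) (L ++ R) above) (length-++ L)))))
  where
  above : all (a <ᵇ_) (L ++ R) ≡ true
  above = all-mono₂ (λ y a≤y a≢y → <⇒<ᵇ≡true (≤∧≢⇒< (≤ᵇ≡true⇒≤ a y a≤y) (not-≡ᵇ⇒≢ a y a≢y)))
                    (L ++ R) (proj₁ (∧≡true⇒× avoids)) (trans (sym (∉ᵇ⇔all a (L ++ R))) a∉L++R)
... | false = large-before⇒many-large a L R avoids a∉L++R
  (trans (sym (cong (_∧ allBelow a L) (≢∧≮⇒>ᵇ a x a≢x a<x))) L≮a)

not-all-above⇒some-below : ∀ a R → a ∉ᵇ R ≡ true → all (a <ᵇ_) R ≡ false → 1 ≤ countᵇ (_<ᵇ a) R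
not-all-above⇒some-below a (y ∷ R) a∉ R≯a with ∧≡true⇒× {not (a ≡ᵇ y)} a∉
... | a≢y , a∉R with a <ᵇ y in a<y
... | true  = ≤-trans (not-all-above⇒some-below a R a∉R R≯a) (m≤n+m _ ⟦ y <ᵇ a ⟧)
... | false rewrite ≢∧≮⇒>ᵇ a y a≢y a<y = s≤s z≤n

-- If a ∷ L ++ R is a 231-avoiding arrangement of 0 … a + b with |L| = a and |R| = b, then
-- L holds the values below a and R those above: by the pigeonhole principle a value above a
-- in L would leave too many values above a, and a value below a in R too many below a.
avoids231From-separates : ∀ a b L R → length L ≡ a → length R ≡ b →
  allBelow (suc (a + b)) (L ++ R) ≡ true → uniqueᵇ (a ∷ L ++ R) ≡ true → avoids231From a (L ++ R) ≡ true →
  allBelow a L ≡ true × all (a <ᵇ_) R ≡ true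
avoids231From-separates a b L R |L|≡a |R|≡b range unique avoids = L<a , a<R
  where
  a∉ = proj₁ (∧≡true⇒× unique)
  unique-LR = proj₂ (∧≡true⇒× unique)
  few-above : countᵇ (a <ᵇ_) (L ++ R) ≤ b
  few-above = subst (_≤ b) (length-filterᵇ (a <ᵇ_) (L ++ R))
    (uniqueᵇ-within⇒length≤ b (suc a) (filterᵇ (a <ᵇ_) (L ++ R)) (uniqueᵇ-filterᵇ _ (L ++ R) unique-LR)
      (all-mono₂ (λ x a<x x<n → cong₂ _∧_ (<⇒<ᵇ≡true (<ᵇ≡true⇒< a x a<x)) x<n)
        (filterᵇ (a <ᵇ_) (L ++ R)) (all-filterᵇ (a <ᵇ_) (L ++ R)) (filterᵇ-all (a <ᵇ_) _ (L ++ R) range)))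
  few-below : countᵇ (_<ᵇ a) (L ++ R) ≤ a
  few-below = subst (_≤ a) (length-filterᵇ (_<ᵇ a) (L ++ R))
    (uniqueᵇ-within⇒length≤ a 0 (filterᵇ (_<ᵇ a) (L ++ R)) (uniqueᵇ-filterᵇ _ (L ++ R) unique-LR)
      (all-filterᵇ (_<ᵇ a) (L ++ R)))
  L<a : allBelow a L ≡ true
  L<a with allBelow a L in L≮a
  ... | true  = refl
  ... | false = ⊥-elim (<⇒≱ (subst (λ r → suc r ≤ countᵇ (a <ᵇ_) (L ++ R)) |R|≡b
                              (large-before⇒many-large a L R avoids a∉ L≮a)) few-above)
  a<R : all (a <ᵇ_) R ≡ true
  a<R with all (a <ᵇ_) R in R≯a
  ... | true  = refl
  ... | false = ⊥-elim (<⇒≱ many-below few-below)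
    where
    many-below : a < countᵇ (_<ᵇ a) (L ++ R)
    many-below = subst₂ _<_ (trans (countᵇ-all (_<ᵇ a) L L<a) |L|≡a) (sym (countᵇ-++ (_<ᵇ a) L R))
      (m<m+n _ (not-all-above⇒some-below a R (proj₂ (∧≡true⇒× (trans (sym (∉ᵇ-++ a L R)) a∉))) R≯a))

module FirstEntry (a : ℕ) (L R : List ℕ) (L<a : allBelow a L ≡ true) where

  R′ : List ℕ
  R′ = map (suc a +_) R

  a<R′ : all (a <ᵇ_) R′ ≡ true
  a<R′ = trans (all-map (a <ᵇ_) (suc a +_) R)
    (all-mono (λ y _ → <⇒<ᵇ≡true (s≤s (m≤m+n a y))) R (all-const R))

  a≤R′ : all (a ≤ᵇ_) R′ ≡ true
  a≤R′ = all-mono (λ y a<y → ≤⇒≤ᵇ≡true (<⇒≤ (<ᵇ≡true⇒< a y a<y))) R′ a<R′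

  L≤R′ : all (λ x → all (x ≤ᵇ_) R′) L ≡ true
  L≤R′ = all-mono (λ x x<a → all-mono (λ y a<y →
    ≤⇒≤ᵇ≡true (<⇒≤ (<-trans (<ᵇ≡true⇒< x a x<a) (<ᵇ≡true⇒< a y a<y)))) R′ a<R′) L L<a

  L∉R′ : all (_∉ᵇ R′) L ≡ true
  L∉R′ = all-mono (λ x x<a → ∉ᵇ-excluded x R′ (λ y a<y x≡y →
    <-irrefl x≡y (<-trans (<ᵇ≡true⇒< x a x<a) (<ᵇ≡true⇒< a y a<y))) a<R′) L L<a

  a∉LR′ : a ∉ᵇ (L ++ R′) ≡ true
  a∉LR′ = trans (∉ᵇ-++ a L R′) (cong₂ _∧_
    (∉ᵇ-excluded a L (λ y y<a a≡y → <-irrefl (sym a≡y) (<ᵇ≡true⇒< y a y<a)) L<a)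
    (∉ᵇ-excluded a R′ (λ y a<y a≡y → <-irrefl a≡y (<ᵇ≡true⇒< a y a<y)) a<R′))

  uniqueᵇ-split : uniqueᵇ (a ∷ L ++ R′) ≡ (uniqueᵇ L ∧ uniqueᵇ R)
  uniqueᵇ-split =
    trans (cong₂ _∧_ a∉LR′ (uniqueᵇ-++ L R′ L∉R′)) (cong (uniqueᵇ L ∧_) (uniqueᵇ-+ˡ (suc a) R))

  avoids231ᵇ-split : avoids231ᵇ (a ∷ L ++ R′) ≡ (avoids231ᵇ L ∧ avoids231ᵇ R)
  avoids231ᵇ-split = cong₂ _∧_ (trans (avoids231From-++ a L R′ a≤R′) (avoids231From-< a L L<a))
    (trans (avoids231ᵇ-++ L R′ L≤R′) (cong (avoids231ᵇ L ∧_) (avoids231ᵇ-+ˡ (suc a) R)))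

  stat31-2ᵇ-split : stat31-2ᵇ (a ∷ L ++ R′) ≡ (stat31-2ᵇ L + aboveHead L) + stat31-2ᵇ R
  stat31-2ᵇ-split = begin
    occ31-2From a (L ++ R′) + stat31-2ᵇ (L ++ R′)
      ≡⟨ cong₂ _+_ (trans (occ31-2From-++ a L R′ a≤R′) (occ31-2From-< a L L<a))
                   (trans (stat31-2ᵇ-++ L R′ L≤R′) (cong (stat31-2ᵇ L +_) (stat31-2ᵇ-+ˡ (suc a) R))) ⟩
    aboveHead L + (stat31-2ᵇ L + stat31-2ᵇ R)
      ≡⟨ +-assoc (aboveHead L) _ _ ⟨
    aboveHead L + stat31-2ᵇ L + stat31-2ᵇ R
      ≡⟨ cong (_+ stat31-2ᵇ R) (+-comm (aboveHead L) _) ⟩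
    stat31-2ᵇ L + aboveHead L + stat31-2ᵇ R
      ∎

  aboveHead-split : aboveHead (a ∷ L ++ R′) ≡ length R
  aboveHead-split = begin
    countᵇ (a <ᵇ_) (L ++ R′)
      ≡⟨ countᵇ-++ (a <ᵇ_) L R′ ⟩
    countᵇ (a <ᵇ_) L + countᵇ (a <ᵇ_) R′
      ≡⟨ cong₂ _+_ (countᵇ-none (a <ᵇ_) L (all-mono a≮ L L<a)) (countᵇ-all (a <ᵇ_) R′ a<R′) ⟩
    length R′
      ≡⟨ length-map (suc a +_) R ⟩
    length R
      ∎
    where
    a≮ : ∀ y → (y <ᵇ a) ≡ true → not (a <ᵇ y) ≡ true
    a≮ y y<a with a <ᵇ y in a<y
    ... | true  = ⊥-elim (<-asym (<ᵇ≡true⇒< y a y<a) (<ᵇ≡true⇒< a y a<y))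
    ... | false = refl

  avoiding-δ-split : ∀ (X : List ℕ → ℕ) x y k → X (a ∷ L ++ R′) ≡ x + y →
    avoiding (λ w → δ (X w) k) (a ∷ L ++ R′) ≡
    ((λ j → avoiding (λ _ → δ x j) L) ∗ (λ j → avoiding (λ _ → δ y j) R)) k
  avoiding-δ-split X x y k X≡x+y rewrite uniqueᵇ-split | avoids231ᵇ-split | X≡x+y =
    avoiding-split (uniqueᵇ L) (uniqueᵇ R) (avoids231ᵇ L) (avoids231ᵇ R) x y k

  weightF-split : ∀ k → weightF k (a ∷ L ++ R′) ≡ ((λ j → weightG j L) ∗ (λ j → weightF j R)) k
  weightF-split k = avoiding-δ-split stat31-2ᵇ (stat31-2ᵇ L + aboveHead L) (stat31-2ᵇ R) k stat31-2ᵇ-split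

  weightG-split : ∀ k →
    weightG k (a ∷ L ++ R′) ≡ ((λ j → weightG j L) ∗ shift (length R) (λ j → weightF j R)) k
  weightG-split k = begin
    weightG k (a ∷ L ++ R′)
      ≡⟨ avoiding-δ-split (λ w → stat31-2ᵇ w + aboveHead w) (stat31-2ᵇ L + aboveHead L) (stat31-2ᵇ R + b) k
           (trans (cong₂ _+_ stat31-2ᵇ-split aboveHead-split) (+-assoc (stat31-2ᵇ L + aboveHead L) _ _)) ⟩
    ((λ j → weightG j L) ∗ (λ j → avoiding (λ _ → δ (stat31-2ᵇ R + b) j) R)) k
      ≡⟨ ∗-cong {f = λ j → weightG j L} (λ _ → refl) shifted k ⟩
    ((λ j → weightG j L) ∗ shift b (λ j → weightF j R)) k
      ∎
    where
    b = length R
    shifted : ∀ j → avoiding (λ _ → δ (stat31-2ᵇ R + b) j) R ≡ shift b (λ j → weightF j R) j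
    shifted j = begin
      ⟦ uniqueᵇ R ⟧ * (⟦ avoids231ᵇ R ⟧ * δ (stat31-2ᵇ R + b) j)
        ≡⟨ cong (λ z → ⟦ uniqueᵇ R ⟧ * (⟦ avoids231ᵇ R ⟧ * z)) (δ-shift (stat31-2ᵇ R) b j) ⟩
      ⟦ uniqueᵇ R ⟧ * (⟦ avoids231ᵇ R ⟧ * shift b (δ (stat31-2ᵇ R)) j)
        ≡⟨ cong (⟦ uniqueᵇ R ⟧ *_) (shift-*ˡ b ⟦ avoids231ᵇ R ⟧ _ j) ⟨
      ⟦ uniqueᵇ R ⟧ * shift b (λ y → ⟦ avoids231ᵇ R ⟧ * δ (stat31-2ᵇ R) y) j
        ≡⟨ shift-*ˡ b ⟦ uniqueᵇ R ⟧ _ j ⟨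
      shift b (λ j → weightF j R) j
        ∎

avoiding-separated : ∀ X a b L R → length L ≡ a → length R ≡ b → allBelow (suc (a + b)) (L ++ R) ≡ true →
  (allBelow a L ∧ all (a <ᵇ_) R) ≡ false → avoiding X (a ∷ L ++ R) ≡ 0
avoiding-separated X a b L R |L| |R| range not-separated with uniqueᵇ (a ∷ L ++ R) in unique
... | false = refl
... | true with avoids231From a (L ++ R) in avoids
... | false = refl
... | true with avoids231From-separates a b L R |L| |R| range unique avoids
... | L<a , a<R = case trans (sym not-separated) (cong₂ _∧_ L<a a<R) of λ ()

sumWords-first-entry : ∀ X a b →
  sumWords (a + b) (suc (a + b)) (λ v → avoiding X (a ∷ v)) ≡
  sumWords a a (λ L → sumWords b b (λ R → avoiding X (a ∷ L ++ map (suc a +_) R)))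
sumWords-first-entry X a b = begin
  sumWords (a + b) n (λ v → avoiding X (a ∷ v))
    ≡⟨ sumWords-++ a b n _ ⟩
  sumWords a n (λ L → sumWords b n (λ R → avoiding X (a ∷ L ++ R)))
    ≡⟨ sumWords-cong a n restrict-right ⟩
  sumWords a n (λ L → sumWords b b (λ R → avoiding X (a ∷ L ++ map (suc a +_) R)))
    ≡⟨ sumWords-window a 0 a n _ (≤-trans (m≤m+n a b) (n≤1+n _)) vanish-left ⟩
  sumWords a a (λ L → sumWords b b (λ R → avoiding X (a ∷ map (0 +_) L ++ map (suc a +_) R)))
    ≡⟨ sumWords-cong a a (λ L _ _ →
         cong (λ L′ → sumWords b b (λ R → avoiding X (a ∷ L′ ++ map (suc a +_) R))) (map-id L)) ⟩
  sumWords a a (λ L → sumWords b b (λ R → avoiding X (a ∷ L ++ map (suc a +_) R)))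
    ∎
  where
  n = suc (a + b)
  right-not-above : ∀ R → allBelow n R ≡ true → allWithin (suc a) b R ≡ false → all (a <ᵇ_) R ≡ false
  right-not-above R R<n R∉ with all (a <ᵇ_) R in a<R
  ... | false = refl
  ... | true  = trans (sym (all-mono₂ (λ y a<y y<n → cong₂ _∧_ (≤⇒≤ᵇ≡true (<ᵇ≡true⇒< a y a<y)) y<n) R a<R R<n)) R∉
  restrict-right : ∀ L → length L ≡ a → allBelow n L ≡ true →
    sumWords b n (λ R → avoiding X (a ∷ L ++ R)) ≡ sumWords b b (λ R → avoiding X (a ∷ L ++ map (suc a +_) R))
  restrict-right L |L| L<n = sumWords-window b (suc a) b n _ ≤-refl (λ R |R| R<n R∉ →
    avoiding-separated X a b L R |L| |R| (trans (all-++ _ L R) (cong₂ _∧_ L<n R<n))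
      (trans (cong (allBelow a L ∧_) (right-not-above R R<n R∉)) (∧-zeroʳ _)))
  shifted-below : ∀ R → allBelow b R ≡ true → allBelow n (map (suc a +_) R) ≡ true
  shifted-below R R<b = trans (all-map _ (suc a +_) R)
    (all-mono (λ y y<b → <⇒<ᵇ≡true (s≤s (+-monoʳ-< a (<ᵇ≡true⇒< y b y<b)))) R R<b)
  vanish-left : ∀ L → length L ≡ a → allBelow n L ≡ true → allWithin 0 a L ≡ false →
    sumWords b b (λ R → avoiding X (a ∷ L ++ map (suc a +_) R)) ≡ 0
  vanish-left L |L| L<n L∉ = sumWords-zero b b (λ R |R| R<b →
    avoiding-separated X a b L (map (suc a +_) R) |L| (trans (length-map _ R) |R|)
      (trans (all-++ _ L _) (cong₂ _∧_ L<n (shifted-below R R<b))) (cong (_∧ _) L∉))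

F-first-entry : ∀ a b k → sumWords (a + b) (suc (a + b)) (λ v → weightF k (a ∷ v)) ≡ (G a ∗ F b) k
F-first-entry a b k = begin
  sumWords (a + b) (suc (a + b)) (λ v → weightF k (a ∷ v))
    ≡⟨ sumWords-first-entry (λ w → δ (stat31-2ᵇ w) k) a b ⟩
  sumWords a a (λ L → sumWords b b (λ R → weightF k (a ∷ L ++ map (suc a +_) R)))
    ≡⟨ sumWords-cong a a (λ L _ L<a → sumWords-cong b b (λ R _ _ → FirstEntry.weightF-split a L R L<a k)) ⟩
  sumWords a a (λ L → sumWords b b (λ R → ((λ j → weightG j L) ∗ (λ j → weightF j R)) k))
    ≡⟨ sumWords-∗ a a b b (λ L j → weightG j L) (λ R j → weightF j R) k ⟩
  (G a ∗ F b) k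
    ∎

G-first-entry : ∀ a b k → sumWords (a + b) (suc (a + b)) (λ v → weightG k (a ∷ v)) ≡ (G a ∗ shift b (F b)) k
G-first-entry a b k = begin
  sumWords (a + b) (suc (a + b)) (λ v → weightG k (a ∷ v))
    ≡⟨ sumWords-first-entry (λ w → δ (stat31-2ᵇ w + aboveHead w) k) a b ⟩
  sumWords a a (λ L → sumWords b b (λ R → weightG k (a ∷ L ++ map (suc a +_) R)))
    ≡⟨ sumWords-cong a a (λ L _ L<a → sumWords-cong b b (λ R |R| _ →
         trans (FirstEntry.weightG-split a L R L<a k)
               (cong (λ c → ((λ j → weightG j L) ∗ shift c (λ j → weightF j R)) k) |R|))) ⟩
  sumWords a a (λ L → sumWords b b (λ R → ((λ j → weightG j L) ∗ shift b (λ j → weightF j R)) k))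
    ≡⟨ sumWords-∗ a a b b (λ L j → weightG j L) (λ R → shift b (λ j → weightF j R)) k ⟩
  (G a ∗ (λ j → sumWords b b (λ R → shift b (λ j → weightF j R) j))) k
    ≡⟨ ∗-cong {f = G a} (λ _ → refl) (sumWords-shift b b b (λ j R → weightF j R)) k ⟩
  (G a ∗ shift b (F b)) k
    ∎

sumWords-suc : ∀ n (h : ℕ → ℕ → ℕ) (g : List ℕ → ℕ) →
  (∀ a b → sumWords (a + b) (suc (a + b)) (λ v → g (a ∷ v)) ≡ h a b) →
  sumWords (suc n) (suc n) g ≡ sumTo n (λ i → h i (n ∸ i))
sumWords-suc n h g first-entry = trans (sumBelow-suc n _) (sumTo-cong n split)
  where
  split : ∀ a → a ≤ n → sumWords n (suc n) (λ v → g (a ∷ v)) ≡ h a (n ∸ a)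
  split a a≤n with m≤n⇒∃[o]m+o≡n a≤n
  ... | b , refl rewrite m+n∸m≡n a b = first-entry a b

F-suc : ∀ n k → F (suc n) k ≡ sumTo n (λ i → (G i ∗ F (n ∸ i)) k)
F-suc n k = sumWords-suc n (λ a b → (G a ∗ F b) k) (weightF k) (λ a b → F-first-entry a b k)

G-suc : ∀ n k → G (suc n) k ≡ sumTo n (λ i → shift i (F i ∗ G (n ∸ i)) k)
G-suc n k = begin
  G (suc n) k
    ≡⟨ sumWords-suc n (λ a b → (G a ∗ shift b (F b)) k) (weightG k) (λ a b → G-first-entry a b k) ⟩
  sumTo n (λ i → (G i ∗ shift (n ∸ i) (F (n ∸ i))) k)
    ≡⟨ sumTo-reverse n _ ⟩
  sumTo n (λ i → (G (n ∸ i) ∗ shift (n ∸ (n ∸ i)) (F (n ∸ (n ∸ i)))) k)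
    ≡⟨ sumTo-cong n (λ i i≤n → cong (λ j → (G (n ∸ i) ∗ shift j (F j)) k) (m∸[m∸n]≡n i≤n)) ⟩
  sumTo n (λ i → (G (n ∸ i) ∗ shift i (F i)) k)
    ≡⟨ sumTo-cong n (λ i _ →
         trans (∗-shiftʳ i (G (n ∸ i)) (F i) k) (shift-cong i (∗-comm (G (n ∸ i)) (F i)) k)) ⟩
  sumTo n (λ i → shift i (F i ∗ G (n ∸ i)) k)
    ∎

F-zero : ∀ k → F 0 k ≡ one 0 k
F-zero zero    = refl
F-zero (suc k) = refl

G-zero : ∀ k → G 0 k ≡ one 0 k
G-zero zero    = refl
G-zero (suc k) = refl

-- Permutations as words

length-filter≡sum : ∀ {A : Set} {P : A → Set} (P? : Decidable P) xs →
  length (filter P? xs) ≡ sum (map (⟦_⟧ ∘ does ∘ P?) xs)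
length-filter≡sum P? []       = refl
length-filter≡sum P? (x ∷ xs) with does (P? x)
... | true  = cong suc (length-filter≡sum P? xs)
... | false = length-filter≡sum P? xs

sum-map-++ : ∀ {A : Set} (W : A → ℕ) xs ys → sum (map W (xs ++ ys)) ≡ sum (map W xs) + sum (map W ys)
sum-map-++ W xs ys = trans (cong sum (map-++ W xs ys)) (sum-++ (map W xs) (map W ys))

sum-map-concatMap : ∀ {A B : Set} (W : B → ℕ) (f : A → List B) xs →
  sum (map W (concatMap f xs)) ≡ sum (map (λ x → sum (map W (f x))) xs)
sum-map-concatMap W f []       = refl
sum-map-concatMap W f (x ∷ xs) =
  trans (sum-map-++ W (f x) (concatMap f xs)) (cong (sum (map W (f x)) +_) (sum-map-concatMap W f xs))

word : ∀ {m n} → Vec (Fin m) n → List ℕ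
word σ = toList (Vec.map toℕ σ)

sum-allVec : ∀ n m (W : Vec (Fin m) n → ℕ) (g : List ℕ → ℕ) → (∀ σ → W σ ≡ g (word σ)) →
  sum (map W (allVec n m)) ≡ sumWords n m g
sum-allVec zero    m W g W≡g = trans (+-identityʳ (W [])) (W≡g [])
sum-allVec (suc n) m W g W≡g = begin
  sum (map W (concatMap (λ x → map (x ∷_) (allVec n m)) (allFin m)))
    ≡⟨ sum-map-concatMap W _ (allFin m) ⟩
  sum (map (λ x → sum (map W (map (x ∷_) (allVec n m)))) (allFin m))
    ≡⟨ cong sum (map-cong (λ x → trans (cong sum (sym (map-∘ (allVec n m))))
         (sum-allVec n m (W ∘ (x ∷_)) (λ v → g (toℕ x ∷ v)) (W≡g ∘ (x ∷_)))) (allFin m)) ⟩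
  sum (map (λ x → sumWords n m (λ v → g (toℕ x ∷ v))) (allFin m))
    ≡⟨ cong sum (map-tabulate {n = m} id (λ x → sumWords n m (λ v → g (toℕ x ∷ v)))) ⟩
  sumBelow m (λ x → sumWords n m (λ v → g (x ∷ v)))
    ∎

does-≡ : ∀ {P : Set} (P? : Dec P) {b : Bool} → (P → b ≡ true) → (b ≡ true → P) → does P? ≡ b
does-≡ (yes p) p⇒b _ = sym (p⇒b p)
does-≡ (no ¬p) {true}  _ b⇒p = ⊥-elim (¬p (b⇒p refl))
does-≡ (no ¬p) {false} _ _   = refl

∉ᵇ⇒lookup≢ : ∀ {n} x (u : Vec ℕ n) → x ∉ᵇ toList u ≡ true → ∀ j → lookup u j ≢ x
∉ᵇ⇒lookup≢ x (y ∷ u) x∉ zero    y≡x = not-≡ᵇ⇒≢ x y (proj₁ (∧≡true⇒× {not (x ≡ᵇ y)} x∉)) (sym y≡x)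
∉ᵇ⇒lookup≢ x (y ∷ u) x∉ (suc j) = ∉ᵇ⇒lookup≢ x u (proj₂ (∧≡true⇒× {not (x ≡ᵇ y)} x∉)) j

∈ᵇ⇒lookup≡ : ∀ {n} x (u : Vec ℕ n) → x ∉ᵇ toList u ≡ false → ∃ λ j → lookup u j ≡ x
∈ᵇ⇒lookup≡ x (y ∷ u) x∈ with x ≡ᵇ y in x≡y
... | true  = zero , sym (≡ᵇ≡true⇒≡ x y x≡y)
... | false = let j , u[j]≡x = ∈ᵇ⇒lookup≡ x u x∈ in suc j , u[j]≡x

uniqueᵇ⇒injective : ∀ {n} (u : Vec ℕ n) → uniqueᵇ (toList u) ≡ true → Injective _≡_ _≡_ (lookup u)
uniqueᵇ⇒injective (x ∷ u) _      {zero}  {zero}  _     = refl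
uniqueᵇ⇒injective (x ∷ u) unique {zero}  {suc j} x≡uj  =
  ⊥-elim (∉ᵇ⇒lookup≢ x u (proj₁ (∧≡true⇒× unique)) j (sym x≡uj))
uniqueᵇ⇒injective (x ∷ u) unique {suc i} {zero}  ui≡x  =
  ⊥-elim (∉ᵇ⇒lookup≢ x u (proj₁ (∧≡true⇒× unique)) i ui≡x)
uniqueᵇ⇒injective (x ∷ u) unique {suc i} {suc j} ui≡uj =
  cong suc (uniqueᵇ⇒injective u (proj₂ (∧≡true⇒× {x ∉ᵇ toList u} unique)) ui≡uj)

injective⇒uniqueᵇ : ∀ {n} (u : Vec ℕ n) → Injective _≡_ _≡_ (lookup u) → uniqueᵇ (toList u) ≡ true
injective⇒uniqueᵇ []      _   = refl
injective⇒uniqueᵇ (x ∷ u) inj = cong₂ _∧_ x∉u (injective⇒uniqueᵇ u (Fin.suc-injective ∘ inj))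
  where
  x∉u : x ∉ᵇ toList u ≡ true
  x∉u with x ∉ᵇ toList u in x∈
  ... | true  = refl
  ... | false with ∈ᵇ⇒lookup≡ x u x∈
  ... | j , uj≡x = case inj {suc j} {zero} uj≡x of λ ()

lookup-word : ∀ {m n} (σ : Vec (Fin m) n) i → lookup (Vec.map toℕ σ) i ≡ toℕ (lookup σ i)
lookup-word σ i = lookup-map i toℕ σ

isPerm?≡uniqueᵇ : ∀ {n} (σ : Vec (Fin n) n) → does (isPerm? σ) ≡ uniqueᵇ (word σ)
isPerm?≡uniqueᵇ σ = does-≡ (isPerm? σ)
  (λ perm → injective⇒uniqueᵇ (Vec.map toℕ σ) (λ {i} {j} eq →
    perm i j (Fin.toℕ-injective (trans (sym (lookup-word σ i)) (trans eq (lookup-word σ j))))))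
  (λ unique i j eq → uniqueᵇ⇒injective (Vec.map toℕ σ) unique
    (trans (lookup-word σ i) (trans (cong toℕ eq) (sym (lookup-word σ j)))))

Occ231ℕ : ∀ {n} → Vec ℕ n → Fin n → Fin n → Fin n → Set
Occ231ℕ u i j k = (toℕ i < toℕ j) × (toℕ j < toℕ k) × (lookup u k < lookup u i) × (lookup u i < lookup u j)

lookup<⇒¬all≥ : ∀ {n} x (v : Vec ℕ n) k → lookup v k < x → all (x ≤ᵇ_) (toList v) ≡ false
lookup<⇒¬all≥ x (y ∷ v) zero    y<x with x ≤ᵇ y in x≤y
... | true  = ⊥-elim (<⇒≱ y<x (≤ᵇ≡true⇒≤ x y x≤y))
... | false = refl
lookup<⇒¬all≥ x (y ∷ v) (suc k) vk<x = trans (cong ((x ≤ᵇ y) ∧_) (lookup<⇒¬all≥ x v k vk<x)) (∧-zeroʳ _)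

¬all≥⇒lookup< : ∀ {n} x (v : Vec ℕ n) → all (x ≤ᵇ_) (toList v) ≡ false → ∃ λ k → lookup v k < x
¬all≥⇒lookup< x (y ∷ v) fails with x ≤ᵇ y in x≤y
... | false = zero , ≰⇒> (λ x≤y′ → case trans (sym x≤y) (≤⇒≤ᵇ≡true x≤y′) of λ ())
... | true  = let k , vk<x = ¬all≥⇒lookup< x v fails in suc k , vk<x

occ⇒¬avoids231From : ∀ {n} x (u : Vec ℕ n) j k → toℕ j < toℕ k → lookup u k < x → x < lookup u j →
  avoids231From x (toList u) ≡ false
occ⇒¬avoids231From x (y ∷ v) zero (suc k) _ vk<x x<y rewrite <⇒<ᵇ≡true x<y | lookup<⇒¬all≥ x v k vk<x = refl
occ⇒¬avoids231From x (y ∷ v) (suc j) (suc k) (s≤s j<k) vk<x x<vj =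
  trans (cong ((if x <ᵇ y then all (x ≤ᵇ_) (toList v) else true) ∧_) (occ⇒¬avoids231From x v j k j<k vk<x x<vj))
        (∧-zeroʳ _)

¬avoids231From⇒occ : ∀ {n} x (u : Vec ℕ n) → avoids231From x (toList u) ≡ false →
  ∃ λ j → ∃ λ k → toℕ j < toℕ k × lookup u k < x × x < lookup u j
¬avoids231From⇒occ x (y ∷ v) fails with x <ᵇ y in x<y
... | false = let j , k , j<k , vk<x , x<vj = ¬avoids231From⇒occ x v fails
              in suc j , suc k , s≤s j<k , vk<x , x<vj
... | true with all (x ≤ᵇ_) (toList v) in x≤v
...   | false = let k , vk<x = ¬all≥⇒lookup< x v x≤v in zero , suc k , s≤s z≤n , vk<x , <ᵇ≡true⇒< x y x<y
...   | true  = let j , k , j<k , vk<x , x<vj = ¬avoids231From⇒occ x v fails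
                in suc j , suc k , s≤s j<k , vk<x , x<vj

occ⇒¬avoids231ᵇ : ∀ {n} (u : Vec ℕ n) i j k → Occ231ℕ u i j k → avoids231ᵇ (toList u) ≡ false
occ⇒¬avoids231ᵇ (x ∷ u) zero    (suc j) (suc k) (_ , s≤s j<k , uk<x , x<uj) =
  cong (_∧ avoids231ᵇ (toList u)) (occ⇒¬avoids231From x u j k j<k uk<x x<uj)
occ⇒¬avoids231ᵇ (x ∷ u) (suc i) (suc j) (suc k) (s≤s i<j , s≤s j<k , uk<ui , ui<uj) =
  trans (cong (avoids231From x (toList u) ∧_) (occ⇒¬avoids231ᵇ u i j k (i<j , j<k , uk<ui , ui<uj)))
        (∧-zeroʳ _)

¬avoids231ᵇ⇒occ : ∀ {n} (u : Vec ℕ n) → avoids231ᵇ (toList u) ≡ false →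
  ∃ λ i → ∃ λ j → ∃ λ k → Occ231ℕ u i j k
¬avoids231ᵇ⇒occ (x ∷ u) fails with avoids231ᵇ (toList u) in tail-fails
... | false = let i , j , k , i<j , j<k , uk<ui , ui<uj = ¬avoids231ᵇ⇒occ u tail-fails
              in suc i , suc j , suc k , s≤s i<j , s≤s j<k , uk<ui , ui<uj
... | true  = let j , k , j<k , uk<x , x<uj = ¬avoids231From⇒occ x u (trans (sym (∧-identityʳ _)) fails)
              in zero , suc j , suc k , s≤s z≤n , s≤s j<k , uk<x , x<uj

Occ231ℕ⇒Occ231 : ∀ {n} (σ : Vec (Fin n) n) {i j k} → Occ231ℕ (Vec.map toℕ σ) i j k → Occ231 σ i j k
Occ231ℕ⇒Occ231 σ {i} {j} {k} (i<j , j<k , uk<ui , ui<uj) =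
  i<j , j<k , subst₂ _<_ (lookup-word σ k) (lookup-word σ i) uk<ui ,
              subst₂ _<_ (lookup-word σ i) (lookup-word σ j) ui<uj

Occ231⇒Occ231ℕ : ∀ {n} (σ : Vec (Fin n) n) {i j k} → Occ231 σ i j k → Occ231ℕ (Vec.map toℕ σ) i j k
Occ231⇒Occ231ℕ σ {i} {j} {k} (i<j , j<k , σk<σi , σi<σj) =
  i<j , j<k , subst₂ _<_ (sym (lookup-word σ k)) (sym (lookup-word σ i)) σk<σi ,
              subst₂ _<_ (sym (lookup-word σ i)) (sym (lookup-word σ j)) σi<σj

avoids231?≡avoids231ᵇ : ∀ {n} (σ : Vec (Fin n) n) → does (avoids231? σ) ≡ avoids231ᵇ (word σ)
avoids231?≡avoids231ᵇ σ = does-≡ (avoids231? σ) to from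
  where
  to : Avoids231 σ → avoids231ᵇ (word σ) ≡ true
  to avoids with avoids231ᵇ (word σ) in fails
  ... | true  = refl
  ... | false = let i , j , k , occ = ¬avoids231ᵇ⇒occ (Vec.map toℕ σ) fails
                in ⊥-elim (avoids (i , j , k , Occ231ℕ⇒Occ231 σ occ))
  from : avoids231ᵇ (word σ) ≡ true → Avoids231 σ
  from avoids (i , j , k , occ) =
    case trans (sym avoids) (occ⇒¬avoids231ᵇ (Vec.map toℕ σ) i j k (Occ231⇒Occ231ℕ σ occ)) of λ ()

sum-tabulate-zero : ∀ n {h : Fin n → ℕ} → (∀ i → h i ≡ 0) → sum (tabulate h) ≡ 0
sum-tabulate-zero zero    h≡0 = refl
sum-tabulate-zero (suc n) h≡0 = cong₂ _+_ (h≡0 zero) (sum-tabulate-zero n (h≡0 ∘ suc))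

sum-tabulate-cong : ∀ n {h h′ : Fin n → ℕ} → (∀ i → h i ≡ h′ i) → sum (tabulate h) ≡ sum (tabulate h′)
sum-tabulate-cong n h≡h′ = cong sum (tabulate-cong h≡h′)

sum-map-allFin : ∀ n (W : Fin n → ℕ) → sum (map W (allFin n)) ≡ sum (tabulate W)
sum-map-allFin n W = cong sum (map-tabulate id W)

sum-tabulate-countᵇ : ∀ {n} (p : ℕ → Bool) (v : Vec ℕ n) →
  sum (tabulate (λ j → ⟦ p (lookup v j) ⟧)) ≡ countᵇ p (toList v)
sum-tabulate-countᵇ p []      = refl
sum-tabulate-countᵇ p (y ∷ v) = cong (⟦ p y ⟧ +_) (sum-tabulate-countᵇ p v)

occ31-2ᵇ : ∀ {n} → Vec ℕ n → Fin n → Fin n → Fin n → Bool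
occ31-2ᵇ u i i′ j =
  (toℕ i′ ≡ᵇ suc (toℕ i)) ∧ ((toℕ i′ <ᵇ toℕ j) ∧ ((lookup u i′ <ᵇ lookup u j) ∧ (lookup u j <ᵇ lookup u i)))

stat31-2ℕ : ∀ {n} → Vec ℕ n → ℕ
stat31-2ℕ {n} u = sum (tabulate λ i → sum (tabulate λ i′ → sum (tabulate λ j → ⟦ occ31-2ᵇ u i i′ j ⟧)))

occ31-2ℕ-head : ∀ {n} x (u : Vec ℕ n) →
  sum (tabulate λ i → sum (tabulate λ j → ⟦ occ31-2ᵇ (x ∷ u) zero (suc i) (suc j) ⟧)) ≡ occ31-2From x (toList u)
occ31-2ℕ-head x []              = refl
occ31-2ℕ-head {suc n} x (y ∷ v) = trans
  (cong₂ _+_ (sum-tabulate-countᵇ (λ c → (y <ᵇ c) ∧ (c <ᵇ x)) v)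
             (sum-tabulate-zero n (λ i → sum-tabulate-zero (suc n) (λ j → refl))))
  (+-identityʳ _)

stat31-2ℕ-∷ : ∀ {n} x (u : Vec ℕ n) → stat31-2ℕ (x ∷ u) ≡ occ31-2From x (toList u) + stat31-2ℕ u
stat31-2ℕ-∷ {n} x u = cong₂ _+_
  (trans (cong₂ _+_ (sum-tabulate-zero (suc n) (λ _ → refl))
                    (sum-tabulate-cong n (λ _ → cong₂ _+_ (cong ⟦_⟧ (∧-zeroʳ _)) refl)))
         (occ31-2ℕ-head x u))
  (sum-tabulate-cong n (λ _ → cong₂ _+_ (sum-tabulate-zero (suc n) (λ _ → refl))
                                        (sum-tabulate-cong n (λ _ → cong₂ _+_ (cong ⟦_⟧ (∧-zeroʳ _)) refl))))

stat31-2ℕ≡stat31-2ᵇ : ∀ {n} (u : Vec ℕ n) → stat31-2ℕ u ≡ stat31-2ᵇ (toList u)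
stat31-2ℕ≡stat31-2ᵇ []      = refl
stat31-2ℕ≡stat31-2ᵇ (x ∷ u) =
  trans (stat31-2ℕ-∷ x u) (cong (occ31-2From x (toList u) +_) (stat31-2ℕ≡stat31-2ᵇ u))

sum-map-triples : ∀ n (W : Fin n × Fin n × Fin n → ℕ) →
  sum (map W (triples n)) ≡ sum (tabulate λ i → sum (tabulate λ i′ → sum (tabulate λ j → W (i , i′ , j))))
sum-map-triples n W = begin
  sum (map W (triples n))
    ≡⟨ sum-map-concatMap W _ (allFin n) ⟩
  sum (map (λ i → sum (map W (concatMap (λ i′ → map (λ j → (i , i′ , j)) (allFin n)) (allFin n)))) (allFin n))
    ≡⟨ sum-map-allFin n _ ⟩
  sum (tabulate λ i → sum (map W (concatMap (λ i′ → map (λ j → (i , i′ , j)) (allFin n)) (allFin n))))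
    ≡⟨ sum-tabulate-cong n (λ i → trans (sum-map-concatMap W _ (allFin n))
         (trans (sum-map-allFin n _) (sum-tabulate-cong n (λ i′ →
           trans (cong sum (sym (map-∘ (allFin n)))) (sum-map-allFin n _))))) ⟩
  sum (tabulate λ i → sum (tabulate λ i′ → sum (tabulate λ j → W (i , i′ , j))))
    ∎

stat31-2≡stat31-2ᵇ : ∀ {n} (σ : Vec (Fin n) n) → stat31-2 σ ≡ stat31-2ᵇ (word σ)
stat31-2≡stat31-2ᵇ {n} σ = begin
  length (filter (occ31-2? σ) (triples n))
    ≡⟨ length-filter≡sum (occ31-2? σ) (triples n) ⟩
  sum (map (⟦_⟧ ∘ does ∘ occ31-2? σ) (triples n))
    ≡⟨ sum-map-triples n _ ⟩
  sum (tabulate λ i → sum (tabulate λ i′ → sum (tabulate λ j → ⟦ does (occ31-2? σ (i , i′ , j)) ⟧)))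
    ≡⟨ sum-tabulate-cong n (λ i → sum-tabulate-cong n (λ i′ → sum-tabulate-cong n (λ j →
         cong ⟦_⟧ (occ≡ i i′ j)))) ⟩
  stat31-2ℕ (Vec.map toℕ σ)
    ≡⟨ stat31-2ℕ≡stat31-2ᵇ (Vec.map toℕ σ) ⟩
  stat31-2ᵇ (word σ)
    ∎
  where
  occ≡ : ∀ i i′ j → does (occ31-2? σ (i , i′ , j)) ≡ occ31-2ᵇ (Vec.map toℕ σ) i i′ j
  occ≡ i i′ j rewrite lookup-word σ i | lookup-word σ i′ | lookup-word σ j = refl

permCount≡F : ∀ n k → permCount n k ≡ F n k
permCount≡F n k = trans (length-filter≡sum _ (allVec n n)) (sum-allVec n n _ (weightF k) weight≡)
  where
  weight≡ : ∀ σ → ⟦ does (isPerm? σ) ∧ (does (avoids231? σ) ∧ (stat31-2 σ ≡ᵇ k)) ⟧ ≡ weightF k (word σ)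
  weight≡ σ = begin
    ⟦ does (isPerm? σ) ∧ (does (avoids231? σ) ∧ (stat31-2 σ ≡ᵇ k)) ⟧
      ≡⟨ ⟦∧⟧ (does (isPerm? σ)) _ ⟩
    ⟦ does (isPerm? σ) ⟧ * ⟦ does (avoids231? σ) ∧ (stat31-2 σ ≡ᵇ k) ⟧
      ≡⟨ cong (⟦ does (isPerm? σ) ⟧ *_) (⟦∧⟧ (does (avoids231? σ)) _) ⟩
    ⟦ does (isPerm? σ) ⟧ * (⟦ does (avoids231? σ) ⟧ * δ (stat31-2 σ) k)
      ≡⟨ cong₂ (λ u v → ⟦ u ⟧ * (⟦ v ⟧ * δ (stat31-2 σ) k)) (isPerm?≡uniqueᵇ σ) (avoids231?≡avoids231ᵇ σ) ⟩
    ⟦ uniqueᵇ (word σ) ⟧ * (⟦ avoids231ᵇ (word σ) ⟧ * δ (stat31-2 σ) k)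
      ≡⟨ cong (λ s → ⟦ uniqueᵇ (word σ) ⟧ * (⟦ avoids231ᵇ (word σ) ⟧ * δ s k)) (stat31-2≡stat31-2ᵇ σ) ⟩
    weightF k (word σ)
      ∎

theorem3p10 : ∀ (n : ℕ) → ∃ λ (D : ℕ) → ∀ (d : ℕ) → D ≤ d →
    ∀ (k : ℕ) → convergent d 0 n k ≡ permCount n k
theorem3p10 n = n , λ d n≤d k → begin
  convergent d 0 n k  ≡⟨ convergent-stabilises n d n≤d k ⟩
  F n k               ≡⟨ permCount≡F n k ⟨
  permCount n k       ∎
  where open Convergents F G F-zero G-zero F-suc G-suc
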